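{- Let $u$ and $v$ be two adjacent vertices of a tree $T$, and let $T_{(v\to u)}$ be the tree obtained from $T$ by replacing the edge $vw$ by the edge $uw$ for every $w\in N_T(v)\setminus\{u\}$. Then $$\mu(T_{(v\to u)};v)\ge \mu(T;u)\qquad\text{and}\qquad \mu(T;v)\ge \mu(T_{(v\to u)};u).$$ Moreover, equality holds in the first inequality if and only if either $u$ is a leaf of $T$ or $T$ is a path with $v$ as a leaf; and equality holds in the second inequality if and only if the connected component of $T-v$ containing $u$ is a path having $u$ as a leaf (this includes the case that this component consists of $u$ alone).
   Context: For a tree $T$ and a vertex $x$ of $T$, $\mu(T;x)$ denotes the local mean order of subtrees of $T$ at $x$: the average number of vertices of the subtrees (connected subgraphs) of $T$ that contain $x$. $N_T(x)$ is the set of neighbours of $x$ in $T$. -}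

module Defs where

open import Data.Nat using (ℕ; zero; suc)
open import Data.Bool using (Bool; true; false; _∨_)
open import Data.Fin using (Fin; _≟_)
open import Data.Fin.Subset using (Subset; ∣_∣) renaming (_∈_ to _∈ₛ_)
open import Data.List using (List; []; _∷_; length; map)
open import Data.Nat.ListAction using (sum)
open import Data.List.Relation.Unary.Unique.Propositional using (Unique)
open import Data.List.Membership.Propositional using (_∈_)
open import Data.Product using (Σ; ∃; _×_; _,_)
open import Data.Sum using (_⊎_)
open import Data.Unit using (⊤)
open import Data.Empty using (⊥)
open import Data.Integer using (+_)
open import Data.Rational using (ℚ; 0ℚ; _/_)
open import Relation.Nullary using (¬_; yes; no)
open import Relation.Nullary.Decidable using (isYes)
open import Relation.Binary.PropositionalEquality using (_≡_)
open import Function.Bundles using (_⇔_)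

Graph : ℕ → Set
Graph n = Fin n → Fin n → Bool

Adj : ∀ {n} → Graph n → Fin n → Fin n → Set
Adj G x y = G x y ≡ true

data WalkIn {n} (G : Graph n) (S : Fin n → Set) : Fin n → Fin n → Set where
  stop : ∀ {x} → S x → WalkIn G S x x
  step : ∀ {x y z} → S x → Adj G x y → WalkIn G S y z → WalkIn G S x z

data Chain {n} (G : Graph n) : List (Fin n) → Set where
  nil  : Chain G []
  one  : ∀ x → Chain G (x ∷ [])
  cons : ∀ {x y xs} → Adj G x y → Chain G (y ∷ xs) → Chain G (x ∷ y ∷ xs)

lastOf : ∀ {A : Set} → A → List A → A
lastOf a [] = a
lastOf a (b ∷ bs) = lastOf b bs

Cycle : ∀ {n} → Graph n → Set
Cycle G = Σ _ λ a → Σ _ λ b → Σ _ λ c → Σ (List _) λ rest →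
  Unique (a ∷ b ∷ c ∷ rest) × Chain G (a ∷ b ∷ c ∷ rest) × Adj G (lastOf c rest) a

Connected : ∀ {n} → Graph n → Set
Connected G = ∀ x y → WalkIn G (λ _ → ⊤) x y

IsTree : ∀ {n} → Graph n → Set
IsTree {n} G = (∀ x y → G x y ≡ G y x) × (∀ x → G x x ≡ false)
              × Fin n × Connected G × ¬ Cycle G

IsLeaf : ∀ {n} → Graph n → Fin n → Set
IsLeaf G x = Σ _ λ w → Adj G x w × (∀ w' → Adj G x w' → w' ≡ w)

-- S induces a connected subgraph of G containing x
-- (in a tree these are exactly the subtrees containing x)
SubtreeAt : ∀ {n} → Graph n → Fin n → Subset n → Set
SubtreeAt G x S = x ∈ₛ S × (∀ a b → a ∈ₛ S → b ∈ₛ S → WalkIn G (_∈ₛ S) a b)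

Enumerates : ∀ {n} → List (Subset n) → (Subset n → Set) → Set
Enumerates L P = Unique L × (∀ S → (S ∈ L) ⇔ P S)

meanOrder : ∀ {n} → List (Subset n) → ℚ
meanOrder L with length L
... | zero = 0ℚ
... | suc k = (+ sum (map ∣_∣ L)) / suc k

-- μ(G;x) = q : q is the average order of the subtrees containing x,
-- computed from a (any) duplicate-free enumeration of them
IsLocalMean : ∀ {n} → Graph n → Fin n → ℚ → Set
IsLocalMean G x q = Σ (List _) λ L → Enumerates L (SubtreeAt G x) × meanOrder L ≡ q

-- T_(v→u): replace the edge vw by uw for every neighbour w ≠ u of v

moveAdj : ∀ {n} → Graph n → Fin n → Fin n → Graph n
moveAdj G u v x y with x ≟ v | y ≟ v
... | yes _ | _     = isYes (y ≟ u)          -- at v only the edge vu remains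
... | no _  | yes _ = isYes (x ≟ u)
... | no _  | no _  with x ≟ u | y ≟ u
...   | yes _ | no _  = G u y ∨ G v y      -- u gains the neighbours of v
...   | no _  | yes _ = G x u ∨ G x v
...   | _     | _     = G x y

data Consec {A : Set} : List A → A → A → Set where
  here  : ∀ {a b xs} → Consec (a ∷ b ∷ xs) a b
  there : ∀ {c xs a b} → Consec xs a b → Consec (c ∷ xs) a b

-- The subgraph of G induced by the vertex set P is a path having x as an
-- end vertex (a leaf; a single vertex x counts as such a path): its
-- vertices can be listed without repetition starting at x so that two
-- vertices of P are adjacent iff they are consecutive in the list.
PathFrom : ∀ {n} → Graph n → (Fin n → Set) → Fin n → Set
PathFrom G P x = Σ (List _) λ L → Σ (List _) λ rest → L ≡ x ∷ rest × Unique L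
  × (∀ a → (a ∈ L) ⇔ P a)
  × (∀ a b → P a → P b → Adj G a b ⇔ (Consec L a b ⊎ Consec L b a))

CompAvoid : ∀ {n} → Graph n → Fin n → Fin n → Fin n → Set
CompAvoid G v u a = WalkIn G (λ z → ¬ z ≡ v) u a

module Submission where

-- Let U (resp. V) be the subtrees of T containing u but not v (resp. v but not u), with
-- a = |U|, b = |V| and total orders sa, sb. The subtrees of T containing both u and v are
-- exactly the unions X ∪ Y with X ∈ U, Y ∈ V; those of T_(v→u) containing u are these and
-- the same sets with v deleted, and those containing v are these and {v}. Hence all four
-- local means are explicit in a, b, sa, sb, and both inequalities reduce to
-- 2a - 1 ≤ sa ≤ a(a + 1)/2 (and likewise for V). The lower bound holds because only {u}
-- has a single vertex. For the upper bound, every size between 1 and the largest one occurs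
-- in U, so the sum of the a sizes is at most 1 + 2 + … + a, with equality iff all sizes are
-- distinct; peeling off u shows that this happens iff the component of T - v containing u
-- is a path starting at u.

module Walks where

  open import Defs
  open import Data.Nat using (ℕ)
  open import Data.Fin using (Fin; _≟_)
  open import Data.Fin.Subset using (Subset) renaming (_∈_ to _∈ₛ_)
  open import Data.List using (List; []; _∷_)
  open import Data.List.Relation.Unary.All using (All; []; _∷_)
  open import Data.List.Relation.Unary.All.Properties using (¬Any⇒All¬)
  open import Data.List.Relation.Unary.AllPairs using ([]; _∷_)
  open import Data.List.Relation.Unary.Any using (here; there)
  open import Data.List.Relation.Unary.Unique.Propositional using (Unique)
  open import Data.List.Membership.Propositional using (_∈_)
  import Data.List.Membership.DecPropositional as DecMembership
  open import Data.Product using (Σ; _×_; _,_)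
  open import Data.Empty using (⊥-elim)
  open import Relation.Nullary using (¬_; Dec; yes; no)
  open import Relation.Binary.PropositionalEquality using (_≡_; refl; trans)

  module _ {n : ℕ} {G : Graph n} where

    walk-start : ∀ {P a b} → WalkIn G P a b → P a
    walk-start (stop p) = p
    walk-start (step p _ _) = p

    walk-end : ∀ {P a b} → WalkIn G P a b → P b
    walk-end (stop p) = p
    walk-end (step _ _ w) = walk-end w

    walk-map : ∀ {P Q : Fin n → Set} → (∀ x → P x → Q x) → ∀ {a b} → WalkIn G P a b → WalkIn G Q a b
    walk-map f (stop p) = stop (f _ p)
    walk-map f (step p e w) = step (f _ p) e (walk-map f w)

    walk-++ : ∀ {P a b c} → WalkIn G P a b → WalkIn G P b c → WalkIn G P a c
    walk-++ (stop _) w' = w'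
    walk-++ (step p e w) w' = step p e (walk-++ w w')

    walk-edge : ∀ {P a b} → P a → P b → Adj G a b → WalkIn G P a b
    walk-edge pa pb e = step pa e (stop pb)

    walk-exit : ∀ {P Q : Fin n → Set} → (∀ x → Dec (Q x)) → ∀ {a b} → WalkIn G P a b → Q a → ¬ Q b →
                Σ (Fin n) λ x → Σ (Fin n) λ y → Q x × ¬ Q y × Adj G x y × P x × P y
    walk-exit Q? (stop _) qa ¬qb = ⊥-elim (¬qb qa)
    walk-exit Q? (step {y = y} p e w) qa ¬qb with Q? y
    ... | yes qy = walk-exit Q? w qy ¬qb
    ... | no ¬qy = _ , y , qa , ¬qy , e , p , walk-start w

    -- A duplicate-free walk, recorded as the list of vertices after its start.
    SimpleWalk : (Fin n → Set) → Fin n → Fin n → Set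
    SimpleWalk P a b = Σ (List (Fin n)) λ xs →
      Unique (a ∷ xs) × Chain G (a ∷ xs) × lastOf a xs ≡ b × All P (a ∷ xs)

    private
      suffix : ∀ {P x a b} xs → x ∈ (a ∷ xs) → Unique (a ∷ xs) → Chain G (a ∷ xs) →
               lastOf a xs ≡ b → All P (a ∷ xs) → SimpleWalk P x b
      suffix xs (here refl) uq ch lst al = xs , uq , ch , lst , al
      suffix (c ∷ cs) (there m) (_ ∷ uq) (cons _ ch) lst (_ ∷ al) = suffix cs m uq ch lst al

    open DecMembership (_≟_ {n}) using (_∈?_)

    walk⇒simple : ∀ {P a b} → WalkIn G P a b → SimpleWalk P a b
    walk⇒simple (stop p) = [] , [] ∷ [] , one _ , refl , p ∷ []
    walk⇒simple {a = a} (step {y = y} p e w) with walk⇒simple w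
    ... | ys , uq , ch , lst , al with a ∈? (y ∷ ys)
    ...   | yes m = suffix ys m uq ch lst al
    ...   | no m = (y ∷ ys) , ¬Any⇒All¬ _ m ∷ uq , cons e ch , lst , p ∷ al

    chain⇒walk : ∀ {P : Fin n → Set} c rest → Chain G (c ∷ rest) → All P (c ∷ rest) →
                 WalkIn G P c (lastOf c rest)
    chain⇒walk c [] _ (p ∷ []) = stop p
    chain⇒walk c (d ∷ rest) (cons e ch) (p ∷ al) = step p e (chain⇒walk d rest ch al)

    module _ (symmetric : ∀ x y → G x y ≡ G y x) where

      adj-sym : ∀ {x y} → Adj G x y → Adj G y x
      adj-sym {x} {y} e = trans (symmetric y x) e

      walk-reverse : ∀ {P a b} → WalkIn G P a b → WalkIn G P b a
      walk-reverse (stop p) = stop p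
      walk-reverse (step p e w) = walk-++ (walk-reverse w) (walk-edge (walk-start w) p (adj-sym e))

  walk-image : ∀ {n} {G G' : Graph n} {P Q : Fin n → Set} (f : Fin n → Fin n) →
               (∀ x → P x → Q (f x)) →
               (∀ x y → P x → P y → Adj G x y → WalkIn G' Q (f x) (f y)) →
               ∀ {a b} → WalkIn G P a b → WalkIn G' Q (f a) (f b)
  walk-image f hQ hE (stop px) = stop (hQ _ px)
  walk-image f hQ hE (step px e w) = walk-++ (hE _ _ px (walk-start w) e) (walk-image f hQ hE w)

  ConnectedOn : ∀ {n} → Graph n → Subset n → Set
  ConnectedOn G S = ∀ a b → a ∈ₛ S → b ∈ₛ S → WalkIn G (_∈ₛ S) a b

module Subsets where

  open import Defs
  open Walks
  open import Data.Nat using (ℕ; suc; _+_; _≤_)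
  open import Data.Nat.Properties using (+-suc; +-comm)
  open import Data.Fin using (Fin; _≟_)
  open import Data.Fin.Subset using (Subset; inside; outside; _∩_; _∪_; ∁; _─_; _-_; ⁅_⁆; _⊆_; ∣_∣)
    renaming (_∈_ to _∈ₛ_; _∉_ to _∉ₛ_)
  open import Data.Fin.Subset.Properties
    using (x∈p∩q⁺; x∈p∩q⁻; x∈p∪q⁺; x∈p∪q⁻; x∉p⇒x∈∁p; x∈p∧x≢y⇒x∈p-y; p─q⊆p; ⊆-antisym;
           x∈⁅x⁆; x∈⁅y⁆⇒x≡y; ∣⁅x⁆∣≡1; p⊆q⇒∣p∣≤∣q∣)
    renaming (_∈?_ to _∈ₛ?_)
  open import Data.Vec using ([]; _∷_; here; there; tabulate)
  open import Data.Vec.Properties using (lookup∘tabulate; []=⇒lookup; lookup⇒[]=)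
  open import Data.Product using (_,_; proj₁; proj₂)
  open import Data.Sum using (_⊎_; inj₁; inj₂)
  open import Data.Empty using (⊥; ⊥-elim)
  open import Relation.Nullary using (Dec; yes; no)
  open import Relation.Nullary.Decidable using (isYes)
  open import Relation.Binary.PropositionalEquality using (_≡_; refl; sym; trans; cong; subst; subst₂)

  module _ {n : ℕ} {Q : Fin n → Set} (Q? : ∀ x → Dec (Q x)) where

    subsetOf : Subset n
    subsetOf = tabulate (λ x → isYes (Q? x))

    ∈-subsetOf⁺ : ∀ {x} → Q x → x ∈ₛ subsetOf
    ∈-subsetOf⁺ {x} q = lookup⇒[]= x subsetOf (trans (lookup∘tabulate _ x) (accept (Q? x) q))
      where
      accept : (d : Dec (Q x)) → Q x → isYes d ≡ _
      accept (yes _) _ = refl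
      accept (no ¬q) q = ⊥-elim (¬q q)

    ∈-subsetOf⁻ : ∀ {x} → x ∈ₛ subsetOf → Q x
    ∈-subsetOf⁻ {x} m = accepted (Q? x) (trans (sym (lookup∘tabulate _ x)) ([]=⇒lookup m))
      where
      accepted : (d : Dec (Q x)) → isYes d ≡ inside → Q x
      accepted (yes q) _ = q
      accepted (no _) ()

  x∈p─q⇒x∉q : ∀ {n x} {p q : Subset n} → x ∈ₛ p ─ q → x ∉ₛ q
  x∈p─q⇒x∉q {p = _ ∷ p} {outside ∷ q} here ()
  x∈p─q⇒x∉q {p = _ ∷ p} {_ ∷ q} (there m) (there m') = x∈p─q⇒x∉q {p = p} m m'

  ∣p∪q∣≡∣p∣+∣q∣ : ∀ {n} (p q : Subset n) → (∀ {z} → z ∈ₛ p → z ∈ₛ q → ⊥) → ∣ p ∪ q ∣ ≡ ∣ p ∣ + ∣ q ∣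
  ∣p∪q∣≡∣p∣+∣q∣ [] [] _ = refl
  ∣p∪q∣≡∣p∣+∣q∣ (inside ∷ p) (inside ∷ q) disj = ⊥-elim (disj here here)
  ∣p∪q∣≡∣p∣+∣q∣ (inside ∷ p) (outside ∷ q) disj =
    cong suc (∣p∪q∣≡∣p∣+∣q∣ p q (λ a b → disj (there a) (there b)))
  ∣p∪q∣≡∣p∣+∣q∣ (outside ∷ p) (inside ∷ q) disj =
    trans (cong suc (∣p∪q∣≡∣p∣+∣q∣ p q (λ a b → disj (there a) (there b)))) (sym (+-suc ∣ p ∣ ∣ q ∣))
  ∣p∪q∣≡∣p∣+∣q∣ (outside ∷ p) (outside ∷ q) disj = ∣p∪q∣≡∣p∣+∣q∣ p q (λ a b → disj (there a) (there b))

  module _ {n : ℕ} where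

    ⁅x⁆⊆p : ∀ {x} {p : Subset n} → x ∈ₛ p → ⁅ x ⁆ ⊆ p
    ⁅x⁆⊆p {x} {p} x∈p m = subst (_∈ₛ p) (sym (x∈⁅y⁆⇒x≡y x m)) x∈p

    ⁅x⁆≡p : ∀ {x} {p : Subset n} → x ∈ₛ p → (∀ {z} → z ∈ₛ p → z ≡ x) → p ≡ ⁅ x ⁆
    ⁅x⁆≡p {x} x∈p only = ⊆-antisym (λ m → subst (_∈ₛ ⁅ x ⁆) (sym (only m)) (x∈⁅x⁆ x)) (⁅x⁆⊆p x∈p)

    x∉p-x : ∀ x (p : Subset n) → x ∉ₛ p - x
    x∉p-x x p m = x∈p─q⇒x∉q {p = p} m (x∈⁅x⁆ x)

    p≡p∩q∪p∩∁q : ∀ (p q : Subset n) → p ≡ (p ∩ q) ∪ (p ∩ ∁ q)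
    p≡p∩q∪p∩∁q p q = ⊆-antisym split join
      where
      split : p ⊆ (p ∩ q) ∪ (p ∩ ∁ q)
      split {z} m with z ∈ₛ? q
      ... | yes z∈q = x∈p∪q⁺ (inj₁ (x∈p∩q⁺ (m , z∈q)))
      ... | no z∉q = x∈p∪q⁺ (inj₂ (x∈p∩q⁺ (m , x∉p⇒x∈∁p z∉q)))
      join : (p ∩ q) ∪ (p ∩ ∁ q) ⊆ p
      join m with x∈p∪q⁻ (p ∩ q) (p ∩ ∁ q) m
      ... | inj₁ m' = proj₁ (x∈p∩q⁻ p q m')
      ... | inj₂ m' = proj₁ (x∈p∩q⁻ p (∁ q) m')

    x∈p∪⁅x⁆ : ∀ x (p : Subset n) → x ∈ₛ p ∪ ⁅ x ⁆
    x∈p∪⁅x⁆ x p = x∈p∪q⁺ (inj₂ (x∈⁅x⁆ x))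

    p⊆p∪⁅x⁆ : ∀ x {p : Subset n} → p ⊆ p ∪ ⁅ x ⁆
    p⊆p∪⁅x⁆ x m = x∈p∪q⁺ (inj₁ m)

    x∈p∪⁅y⁆⁻ : ∀ {x} y (p : Subset n) → x ∈ₛ p ∪ ⁅ y ⁆ → x ∈ₛ p ⊎ x ≡ y
    x∈p∪⁅y⁆⁻ y p m with x∈p∪q⁻ p ⁅ y ⁆ m
    ... | inj₁ m' = inj₁ m'
    ... | inj₂ m' = inj₂ (x∈⁅y⁆⇒x≡y y m')

    p≡p-x∪⁅x⁆ : ∀ {x} {p : Subset n} → x ∈ₛ p → p ≡ (p - x) ∪ ⁅ x ⁆
    p≡p-x∪⁅x⁆ {x} {p} x∈p = ⊆-antisym split join
      where
      split : p ⊆ (p - x) ∪ ⁅ x ⁆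
      split {z} m with z ≟ x
      ... | yes refl = x∈p∪⁅x⁆ x (p - x)
      ... | no z≢x = p⊆p∪⁅x⁆ x (x∈p∧x≢y⇒x∈p-y m z≢x)
      join : (p - x) ∪ ⁅ x ⁆ ⊆ p
      join m with x∈p∪⁅y⁆⁻ x (p - x) m
      ... | inj₁ m' = p─q⊆p p ⁅ x ⁆ m'
      ... | inj₂ refl = x∈p

    ∪⁅x⁆-injective : ∀ x {p q : Subset n} → x ∉ₛ p → x ∉ₛ q → p ∪ ⁅ x ⁆ ≡ q ∪ ⁅ x ⁆ → p ≡ q
    ∪⁅x⁆-injective x x∉p x∉q eq = ⊆-antisym (included x∉p eq) (included x∉q (sym eq))
      where
      included : ∀ {p q} → x ∉ₛ p → p ∪ ⁅ x ⁆ ≡ q ∪ ⁅ x ⁆ → p ⊆ q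
      included {p} {q} x∉p eq {z} m with x∈p∪⁅y⁆⁻ x q (subst (z ∈ₛ_) eq (p⊆p∪⁅x⁆ x m))
      ... | inj₁ m' = m'
      ... | inj₂ refl = ⊥-elim (x∉p m)

    ∣p∪⁅x⁆∣≡1+∣p∣ : ∀ (p : Subset n) x → x ∉ₛ p → ∣ p ∪ ⁅ x ⁆ ∣ ≡ suc ∣ p ∣
    ∣p∪⁅x⁆∣≡1+∣p∣ p x x∉p =
      trans (∣p∪q∣≡∣p∣+∣q∣ p ⁅ x ⁆ (λ a b → x∉p (subst (_∈ₛ p) (x∈⁅y⁆⇒x≡y x b) a)))
            (trans (cong (∣ p ∣ +_) (∣⁅x⁆∣≡1 x)) (+-comm ∣ p ∣ 1))

    x∈p⇒1≤∣p∣ : ∀ {x} {p : Subset n} → x ∈ₛ p → 1 ≤ ∣ p ∣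
    x∈p⇒1≤∣p∣ {x} m = subst (_≤ _) (∣⁅x⁆∣≡1 x) (p⊆q⇒∣p∣≤∣q∣ (⁅x⁆⊆p m))

    ConnectedOn-⁅x⁆ : ∀ {G : Graph n} x → ConnectedOn G ⁅ x ⁆
    ConnectedOn-⁅x⁆ x a b a∈ b∈ with x∈⁅y⁆⇒x≡y x a∈ | x∈⁅y⁆⇒x≡y x b∈
    ... | refl | refl = stop (x∈⁅x⁆ x)

    module _ {G : Graph n} (symmetric : ∀ x y → G x y ≡ G y x) where

      ConnectedOn-∪⁅x⁆ : ∀ {p x z} → ConnectedOn G p → x ∈ₛ p → Adj G x z → ConnectedOn G (p ∪ ⁅ z ⁆)
      ConnectedOn-∪⁅x⁆ {p} {x} {z} conn x∈p e a b a∈ b∈ =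
        walk-++ (toX a a∈) (walk-reverse symmetric (toX b b∈))
        where
        toX : ∀ a → a ∈ₛ p ∪ ⁅ z ⁆ → WalkIn G (_∈ₛ p ∪ ⁅ z ⁆) a x
        toX a m with x∈p∪⁅y⁆⁻ z p m
        ... | inj₁ a∈p = walk-map (λ _ → p⊆p∪⁅x⁆ z) (conn a x a∈p x∈p)
        ... | inj₂ refl = walk-edge (x∈p∪⁅x⁆ z p) (p⊆p∪⁅x⁆ z x∈p) (adj-sym symmetric e)

      -- Walks inside S are retracted into S ∩ R by sending every vertex outside R to x.
      ConnectedOn-∩ : ∀ {S R x} → ConnectedOn G S → x ∈ₛ S → x ∈ₛ R →
                      (∀ {a b} → a ∈ₛ R → b ∉ₛ R → Adj G a b → a ≡ x) → ConnectedOn G (S ∩ R)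
      ConnectedOn-∩ {S} {R} {x} conn x∈S x∈R exit a b a∈ b∈ =
        subst₂ (WalkIn G (_∈ₛ S ∩ R)) (retract-fix (in-R a∈)) (retract-fix (in-R b∈))
          (walk-image (λ z → retract z (z ∈ₛ? R)) vertex edge (conn a b (in-S a∈) (in-S b∈)))
        where
        in-S : ∀ {z} → z ∈ₛ S ∩ R → z ∈ₛ S
        in-S m = proj₁ (x∈p∩q⁻ S R m)
        in-R : ∀ {z} → z ∈ₛ S ∩ R → z ∈ₛ R
        in-R m = proj₂ (x∈p∩q⁻ S R m)
        retract : ∀ z → Dec (z ∈ₛ R) → Fin n
        retract z (yes _) = z
        retract z (no _) = x
        retract-fix : ∀ {z} → z ∈ₛ R → retract z (z ∈ₛ? R) ≡ z
        retract-fix {z} z∈R with z ∈ₛ? R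
        ... | yes _ = refl
        ... | no z∉R = ⊥-elim (z∉R z∈R)
        x∈S∩R : x ∈ₛ S ∩ R
        x∈S∩R = x∈p∩q⁺ (x∈S , x∈R)
        vertex : ∀ z → z ∈ₛ S → retract z (z ∈ₛ? R) ∈ₛ S ∩ R
        vertex z z∈S with z ∈ₛ? R
        ... | yes z∈R = x∈p∩q⁺ (z∈S , z∈R)
        ... | no _ = x∈S∩R
        edge : ∀ z z' → z ∈ₛ S → z' ∈ₛ S → Adj G z z' →
               WalkIn G (_∈ₛ S ∩ R) (retract z (z ∈ₛ? R)) (retract z' (z' ∈ₛ? R))
        edge z z' z∈S z'∈S e with z ∈ₛ? R | z' ∈ₛ? R
        ... | yes z∈R | yes z'∈R = walk-edge (x∈p∩q⁺ (z∈S , z∈R)) (x∈p∩q⁺ (z'∈S , z'∈R)) e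
        ... | no _ | no _ = stop x∈S∩R
        ... | yes z∈R | no z'∉R = subst (λ y → WalkIn G _ y x) (sym (exit z∈R z'∉R e)) (stop x∈S∩R)
        ... | no z∉R | yes z'∈R =
          subst (WalkIn G _ x) (sym (exit z'∈R z∉R (adj-sym symmetric e))) (stop x∈S∩R)

module Enumerations where

  open import Defs
  open import Data.Nat using (ℕ; suc; _+_; _*_)
  open import Data.Nat.Properties using (+-assoc; +-suc; +-identityʳ; *-zeroʳ)
  open import Data.Nat.ListAction using (sum)
  open import Data.Nat.ListAction.Properties using (sum-↭; sum-++)
  open import Data.Nat.Tactic.RingSolver using (solve-∀)
  open import Data.Fin.Subset using (Subset; ∣_∣)
  open import Data.List using (List; []; _∷_; length; map; filter; cartesianProduct)
  open import Data.List.Properties using (length-++; length-map; map-++; map-∘)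
  open import Data.List.Relation.Unary.All as All using ([]; _∷_)
  open import Data.List.Relation.Unary.AllPairs using ([]; _∷_)
  open import Data.List.Relation.Unary.Any using (here; there)
  open import Data.List.Relation.Unary.Unique.Propositional using (Unique)
  open import Data.List.Relation.Unary.Unique.Propositional.Properties using (filter⁺; cartesianProduct⁺)
  open import Data.List.Membership.Propositional using (_∈_)
  open import Data.List.Membership.Propositional.Properties
    using (∈-map⁺; ∈-map⁻; ∈-filter⁺; ∈-filter⁻; ∈-cartesianProduct⁺; ∈-cartesianProduct⁻)
  open import Data.List.Membership.Propositional.Properties.WithK using (unique∧set⇒bag)
  open import Data.List.Relation.Binary.BagAndSetEquality using (∼bag⇒↭)
  open import Data.List.Relation.Binary.Permutation.Propositional using (_↭_)
  open import Data.List.Relation.Binary.Permutation.Propositional.Properties using (map⁺)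
  open import Data.Product using (∃; _×_; _,_; proj₁; proj₂; uncurry)
  open import Data.Empty using (⊥; ⊥-elim)
  open import Function.Bundles using (_⇔_; mk⇔; Equivalence)
  open import Relation.Nullary using (yes; no)
  open import Relation.Unary using (Decidable)
  open import Relation.Unary.Properties using (∁?)
  open import Relation.Binary.PropositionalEquality using (_≡_; refl; sym; trans; cong; cong₂)
  open Equivalence using (to; from)

  module _ {A B : Set} where

    Unique-map⁺ : ∀ (f : A → B) {xs} → (∀ {x y} → x ∈ xs → y ∈ xs → f x ≡ f y → x ≡ y) →
                  Unique xs → Unique (map f xs)
    Unique-map⁺ f {[]} inj [] = []
    Unique-map⁺ f {x ∷ xs} inj (x∉ ∷ uq) =
      All.tabulate (λ m eq → fresh (∈-map⁻ f m) eq) ∷ Unique-map⁺ f (λ m m' → inj (there m) (there m')) uq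
      where
      fresh : ∀ {y} → (∃ λ x' → x' ∈ xs × y ≡ f x') → f x ≡ y → ⊥
      fresh (x' , m , refl) eq = All.lookup x∉ m (inj (here refl) (there m) eq)

    Unique-map⁻ : ∀ (f : A → B) xs {x y} → Unique (map f xs) → x ∈ xs → y ∈ xs → f x ≡ f y → x ≡ y
    Unique-map⁻ f (z ∷ xs) _ (here refl) (here refl) _ = refl
    Unique-map⁻ f (z ∷ xs) (fz∉ ∷ _) (here refl) (there m) eq = ⊥-elim (All.lookup fz∉ (∈-map⁺ f m) eq)
    Unique-map⁻ f (z ∷ xs) (fz∉ ∷ _) (there m) (here refl) eq = ⊥-elim (All.lookup fz∉ (∈-map⁺ f m) (sym eq))
    Unique-map⁻ f (z ∷ xs) (_ ∷ uq) (there m) (there m') eq = Unique-map⁻ f xs uq m m' eq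

  module _ {A : Set} {P : A → Set} (P? : Decidable P) where

    sum-filter-split : ∀ (f : A → ℕ) xs →
      sum (map f xs) ≡ sum (map f (filter P? xs)) + sum (map f (filter (∁? P?) xs))
    sum-filter-split f [] = refl
    sum-filter-split f (x ∷ xs) with P? x
    ... | yes _ = trans (cong (f x +_) (sum-filter-split f xs)) (sym (+-assoc (f x) _ _))
    ... | no _ = trans (cong (f x +_) (sum-filter-split f xs))
                       (swap (f x) (sum (map f (filter P? xs))) (sum (map f (filter (∁? P?) xs))))
      where
      swap : ∀ a b c → a + (b + c) ≡ b + (a + c)
      swap = solve-∀

    length-filter-split : ∀ xs → length xs ≡ length (filter P? xs) + length (filter (∁? P?) xs)
    length-filter-split [] = refl
    length-filter-split (x ∷ xs) with P? x
    ... | yes _ = cong suc (length-filter-split xs)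
    ... | no _ = trans (cong suc (length-filter-split xs)) (sym (+-suc _ _))

    Unique-filter⁻ : ∀ xs → Unique (filter P? xs) → Unique (filter (∁? P?) xs) → Unique xs
    Unique-filter⁻ [] _ _ = []
    Unique-filter⁻ (x ∷ xs) u₁ u₂ with P? x
    Unique-filter⁻ (x ∷ xs) (x∉ ∷ u₁) u₂ | yes px =
      All.tabulate (λ m eq → All.lookup x∉ (∈-filter⁺ P? m (subst' eq px)) eq) ∷ Unique-filter⁻ xs u₁ u₂
      where
      subst' : ∀ {y} → x ≡ y → P x → P y
      subst' refl p = p
    Unique-filter⁻ (x ∷ xs) u₁ (x∉ ∷ u₂) | no ¬px =
      All.tabulate (λ m eq → All.lookup x∉ (∈-filter⁺ (∁? P?) m (λ py → ¬px (subst' (sym eq) py))) eq)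
      ∷ Unique-filter⁻ xs u₁ u₂
      where
      subst' : ∀ {y} → y ≡ x → P y → P x
      subst' refl p = p

  module _ {A : Set} where

    sum-map-cong : ∀ {f g : A → ℕ} {xs} → (∀ {x} → x ∈ xs → f x ≡ g x) → sum (map f xs) ≡ sum (map g xs)
    sum-map-cong {xs = []} eq = refl
    sum-map-cong {xs = x ∷ xs} eq = cong₂ _+_ (eq (here refl)) (sum-map-cong (λ m → eq (there m)))

  module _ {A B : Set} where

    length-cartesianProduct : ∀ (xs : List A) (ys : List B) →
      length (cartesianProduct xs ys) ≡ length xs * length ys
    length-cartesianProduct [] ys = refl
    length-cartesianProduct (x ∷ xs) ys =
      trans (length-++ (map (x ,_) ys))
            (cong₂ _+_ (length-map (x ,_) ys) (length-cartesianProduct xs ys))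

    sum-cartesianProduct : ∀ (f : A → ℕ) (g : B → ℕ) xs ys →
      sum (map (λ p → f (proj₁ p) + g (proj₂ p)) (cartesianProduct xs ys)) ≡
      sum (map f xs) * length ys + sum (map g ys) * length xs
    sum-cartesianProduct f g [] ys = sym (*-zeroʳ (sum (map g ys)))
    sum-cartesianProduct f g (x ∷ xs) ys =
      trans (cong sum (map-++ _ (map (x ,_) ys) (cartesianProduct xs ys)))
      (trans (sum-++ (map _ (map (x ,_) ys)) _)
      (trans (cong₂ _+_ (row ys) (sum-cartesianProduct f g xs ys))
             (regroup (f x) (length ys) (sum (map g ys)) (sum (map f xs)) (length xs))))
      where
      row : ∀ zs → sum (map (λ p → f (proj₁ p) + g (proj₂ p)) (map (x ,_) zs)) ≡ f x * length zs + sum (map g zs)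
      row [] = sym (trans (+-identityʳ _) (*-zeroʳ (f x)))
      row (z ∷ zs) = trans (cong ((f x + g z) +_) (row zs)) (shuffle (f x) (g z) (length zs) (sum (map g zs)))
        where
        shuffle : ∀ a b l s → (a + b) + (a * l + s) ≡ a * suc l + (b + s)
        shuffle = solve-∀
      regroup : ∀ a l s t m → (a * l + s) + (t * l + s * m) ≡ (a + t) * l + s * suc m
      regroup = solve-∀

  sizeSum : ∀ {n} → List (Subset n) → ℕ
  sizeSum L = sum (map ∣_∣ L)

  module _ {n : ℕ} where

    Enumerates-↭ : ∀ {L L' : List (Subset n)} {P P' : Subset n → Set} →
                   Enumerates L P → Enumerates L' P' → (∀ S → P S ⇔ P' S) → L ↭ L'
    Enumerates-↭ {L} {L'} (uL , mL) (uL' , mL') P⇔P' =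
      ∼bag⇒↭ (unique∧set⇒bag uL uL' (λ {S} →
        mk⇔ (λ m → from (mL' S) (to (P⇔P' S) (to (mL S) m)))
            (λ m → from (mL S) (from (P⇔P' S) (to (mL' S) m)))))

    ↭⇒sizeSum≡ : ∀ {L L' : List (Subset n)} → L ↭ L' → sizeSum L ≡ sizeSum L'
    ↭⇒sizeSum≡ p = sum-↭ (map⁺ ∣_∣ p)

    sizeSum-map-suc : ∀ (g : Subset n → Subset n) L → (∀ {S} → S ∈ L → ∣ g S ∣ ≡ suc ∣ S ∣) →
                      sizeSum (map g L) ≡ sizeSum L + length L
    sizeSum-map-suc g [] _ = refl
    sizeSum-map-suc g (S ∷ L) grows =
      trans (cong₂ _+_ (grows (here refl)) (sizeSum-map-suc g L (λ m → grows (there m))))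
            (shift ∣ S ∣ (sizeSum L) (length L))
      where
      shift : ∀ a b c → suc a + (b + c) ≡ (a + b) + suc c
      shift = solve-∀

    Enumerates-⁅⁆ : ∀ (S₀ : Subset n) → Enumerates (S₀ ∷ []) (_≡ S₀)
    Enumerates-⁅⁆ S₀ = [] ∷ [] , λ S → mk⇔ (λ { (here eq) → eq }) here

    Enumerates-filter : ∀ {L P} {Q : Subset n → Set} (Q? : Decidable Q) →
                        Enumerates L P → Enumerates (filter Q? L) (λ S → P S × Q S)
    Enumerates-filter {L} Q? (uL , mL) = filter⁺ Q? uL , λ S →
      mk⇔ (λ m → let (m' , q) = ∈-filter⁻ Q? m in to (mL S) m' , q)
          (λ (p , q) → ∈-filter⁺ Q? (from (mL S) p) q)

    Enumerates-map : ∀ {L P} {R : Subset n → Set} (g : Subset n → Subset n) → Enumerates L P →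
                     (∀ {S S'} → P S → P S' → g S ≡ g S' → S ≡ S') →
                     (∀ S → R S → ∃ λ S' → P S' × S ≡ g S') → (∀ S → P S → R (g S)) →
                     Enumerates (map g L) R
    Enumerates-map {L} {R = R} g (uL , mL) inj onto into =
      Unique-map⁺ g (λ m m' → inj (to (mL _) m) (to (mL _) m')) uL , λ S →
      mk⇔ (λ m → image (∈-map⁻ g m)) (λ r → preimage (onto S r))
      where
      image : ∀ {S} → (∃ λ S' → S' ∈ L × S ≡ g S') → R S
      image (S' , m , refl) = into S' (to (mL S') m)
      preimage : ∀ {S} → (∃ λ S' → _ × S ≡ g S') → S ∈ map g L
      preimage (S' , p , refl) = ∈-map⁺ g (from (mL S') p)

    module _ {L M : List (Subset n)} (_⊕_ : Subset n → Subset n → Subset n) where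

      private
        LM : List (Subset n)
        LM = map (uncurry _⊕_) (cartesianProduct L M)

      Enumerates-⊕ : ∀ {P Q R : Subset n → Set} → Enumerates L P → Enumerates M Q →
        (∀ {X Y X' Y'} → P X → Q Y → P X' → Q Y' → X ⊕ Y ≡ X' ⊕ Y' → X ≡ X' × Y ≡ Y') →
        (∀ S → R S → ∃ λ X → ∃ λ Y → P X × Q Y × S ≡ X ⊕ Y) → (∀ X Y → P X → Q Y → R (X ⊕ Y)) →
        Enumerates LM R
      Enumerates-⊕ {P} {Q} {R} (uL , mL) (uM , mM) inj onto into =
        Unique-map⁺ (uncurry _⊕_) injective (cartesianProduct⁺ uL uM) , λ S →
        mk⇔ (λ m → image (∈-map⁻ (uncurry _⊕_) m)) (λ r → preimage (onto S r))
        where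
        members : ∀ {X Y} → (X , Y) ∈ cartesianProduct L M → P X × Q Y
        members m = let (mX , mY) = ∈-cartesianProduct⁻ L M m in to (mL _) mX , to (mM _) mY
        injective : ∀ {p q} → p ∈ cartesianProduct L M → q ∈ cartesianProduct L M →
                    uncurry _⊕_ p ≡ uncurry _⊕_ q → p ≡ q
        injective {X , Y} {X' , Y'} m m' eq with members m | members m'
        ... | pX , qY | pX' , qY' with inj pX qY pX' qY' eq
        ...   | refl , refl = refl
        image : ∀ {S} → (∃ λ p → p ∈ cartesianProduct L M × S ≡ uncurry _⊕_ p) → R S
        image ((X , Y) , m , refl) = let (pX , qY) = members m in into X Y pX qY
        preimage : ∀ {S} → (∃ λ X → ∃ λ Y → P X × Q Y × S ≡ X ⊕ Y) → S ∈ LM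
        preimage (X , Y , pX , qY , refl) =
          ∈-map⁺ (uncurry _⊕_) (∈-cartesianProduct⁺ (from (mL X) pX) (from (mM Y) qY))

      length-⊕ : length LM ≡ length L * length M
      length-⊕ = trans (length-map _ (cartesianProduct L M)) (length-cartesianProduct L M)

      sizeSum-⊕ : (∀ {X Y} → X ∈ L → Y ∈ M → ∣ X ⊕ Y ∣ ≡ ∣ X ∣ + ∣ Y ∣) →
                  sizeSum LM ≡ sizeSum L * length M + sizeSum M * length L
      sizeSum-⊕ additive =
        trans (cong sum (sym (map-∘ {g = ∣_∣} {f = uncurry _⊕_} (cartesianProduct L M))))
        (trans (sum-map-cong additive')
               (sum-cartesianProduct ∣_∣ ∣_∣ L M))
        where
        additive' : ∀ {p} → p ∈ cartesianProduct L M → ∣ uncurry _⊕_ p ∣ ≡ ∣ proj₁ p ∣ + ∣ proj₂ p ∣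
        additive' {X , Y} m = let (mX , mY) = ∈-cartesianProduct⁻ L M m in additive mX mY

module SizeLists where

  open Enumerations using (length-filter-split; sum-filter-split; Unique-filter⁻)
  open import Data.Nat using (ℕ; zero; suc; _+_; _*_; _∸_; _≤_; _<_; s≤s; z≤n)
    renaming (_≟_ to _≟ℕ_)
  open import Data.Nat.Properties
  open import Data.Nat.ListAction using (sum)
  open import Data.Nat.Tactic.RingSolver using (solve-∀)
  open import Data.List using (List; []; _∷_; length; map; filter)
  open import Data.List.Properties using (map-id)
  open import Data.List.Relation.Unary.Unique.Propositional using (Unique)
  open import Data.List.Relation.Unary.Unique.Propositional.Properties using (filter⁺)
  open import Data.List.Relation.Unary.AllPairs using ([]; _∷_)
  open import Data.List.Relation.Unary.All as All using (All; []; _∷_)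
  open import Data.List.Relation.Unary.Any using ()
  open import Data.List.Membership.Propositional using (_∈_)
  open import Data.List.Membership.Propositional.Properties using (∈-filter⁺; ∈-filter⁻)
  open import Data.Product using (Σ; _×_; _,_; proj₁; proj₂)
  open import Data.Sum using (_⊎_; inj₁; inj₂)
  open import Data.Empty using (⊥-elim)
  open import Function.Bundles using (_⇔_; mk⇔; Equivalence)
  open Equivalence using (to; from)
  open import Relation.Nullary using (yes; no)
  open import Relation.Unary.Properties using (∁?)
  open import Relation.Binary.PropositionalEquality using (_≡_; refl; sym; trans; cong; cong₂; subst; module ≡-Reasoning)
  open import Function using (id)
  open import Data.List.Extrema.Nat using (max; xs≤max; argmax-sel)

  module _ {A : Set} where

    Unique-constant : ∀ (a : A) xs → All (_≡ a) xs → Unique xs → length xs ≤ 1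
    Unique-constant a [] _ _ = z≤n
    Unique-constant a (x ∷ []) _ _ = s≤s z≤n
    Unique-constant a (x ∷ y ∷ xs) (refl ∷ refl ∷ _) ((x≢y ∷ _) ∷ _) = ⊥-elim (x≢y refl)

    length≤1⇒Unique : ∀ (xs : List A) → length xs ≤ 1 → Unique xs
    length≤1⇒Unique [] _ = []
    length≤1⇒Unique (x ∷ []) _ = [] ∷ []
    length≤1⇒Unique (x ∷ y ∷ xs) (s≤s ())

  sum-constant : ∀ m xs → All (_≡ m) xs → sum xs ≡ m * length xs
  sum-constant m [] [] = sym (*-zeroʳ m)
  sum-constant m (x ∷ xs) (refl ∷ xs≡m) = trans (cong (m +_) (sum-constant m xs xs≡m)) (sym (*-suc m (length xs)))

  DownClosed : List ℕ → Set
  DownClosed ns = ∀ {x} → x ∈ ns → ∀ k → 1 ≤ k → k < x → k ∈ ns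

  SumDeficit : List ℕ → Set
  SumDeficit ns = Σ ℕ λ e → 2 * sum ns + e ≡ length ns * suc (length ns) × (e ≡ 0 ⇔ Unique ns)

  private
    Bounded : ℕ → List ℕ → Set
    Bounded m = All (λ x → 1 ≤ x × x ≤ m)

    module Split (m : ℕ) (ns : List ℕ) (bounded : Bounded (suc m) ns) (closed : DownClosed ns)
                 (top : suc m ∈ ns) where

      low top-part : List ℕ
      low = filter (∁? (_≟ℕ suc m)) ns
      top-part = filter (_≟ℕ suc m) ns

      low-bounded : Bounded m low
      low-bounded = All.tabulate λ mem →
        let (m∈ , x≢) = ∈-filter⁻ (∁? (_≟ℕ suc m)) mem
            (1≤x , x≤) = All.lookup bounded m∈
        in 1≤x , ≤-pred (≤∧≢⇒< x≤ x≢)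

      low-closed : DownClosed low
      low-closed mem k 1≤k k<x =
        let (m∈ , _) = ∈-filter⁻ (∁? (_≟ℕ suc m)) mem
        in ∈-filter⁺ (∁? (_≟ℕ suc m)) (closed m∈ k 1≤k k<x)
             (λ k≡ → <-irrefl k≡ (<-≤-trans k<x (proj₂ (All.lookup bounded m∈))))

      low-top : m ≡ 0 ⊎ m ∈ low
      low-top with m ≟ℕ 0
      ... | yes m≡0 = inj₁ m≡0
      ... | no m≢0 = inj₂ (∈-filter⁺ (∁? (_≟ℕ suc m)) (closed top m (n≢0⇒n>0 m≢0) (n<1+n m))
                                     (λ eq → <-irrefl eq (n<1+n m)))

      top-constant : All (_≡ suc m) top-part
      top-constant = All.tabulate λ mem → proj₂ (∈-filter⁻ (_≟ℕ suc m) {xs = ns} mem)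

      top-length : Σ ℕ λ c → length top-part ≡ suc c
      top-length with top-part | ∈-filter⁺ (_≟ℕ suc m) top refl
      ... | _ ∷ xs | _ = length xs , refl

      length-split : length ns ≡ length top-part + length low
      length-split = length-filter-split (_≟ℕ suc m) ns

      sum-split : sum ns ≡ suc m * length top-part + sum low
      sum-split = begin
        sum ns                                              ≡⟨ cong sum (map-id ns) ⟨
        sum (map id ns)                                     ≡⟨ sum-filter-split (_≟ℕ suc m) id ns ⟩
        sum (map id top-part) + sum (map id low)            ≡⟨ cong₂ _+_ (cong sum (map-id top-part)) (cong sum (map-id low)) ⟩
        sum top-part + sum low                              ≡⟨ cong (_+ sum low) (sum-constant (suc m) top-part top-constant) ⟩
        suc m * length top-part + sum low                   ∎
        where open ≡-Reasoning

    deficit-step : ∀ m c d sl el → 2 * sl + el ≡ (m + d) * suc (m + d) →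
      2 * (suc m * suc c + sl) + (el + 2 * d * suc c + suc c * c) ≡ (suc c + (m + d)) * suc (suc c + (m + d))
    deficit-step m c d sl el h = begin
      2 * (suc m * suc c + sl) + (el + 2 * d * suc c + suc c * c)       ≡⟨ regroup m c d sl el ⟩
      (2 * sl + el) + (2 * (m + d) * suc c + suc c * suc (suc c))       ≡⟨ cong (_+ (2 * (m + d) * suc c + suc c * suc (suc c))) h ⟩
      (m + d) * suc (m + d) + (2 * (m + d) * suc c + suc c * suc (suc c)) ≡⟨ expand (m + d) c ⟨
      (suc c + (m + d)) * suc (suc c + (m + d))                         ∎
      where
      open ≡-Reasoning
      regroup : ∀ m c d sl el → 2 * (suc m * suc c + sl) + (el + 2 * d * suc c + suc c * c) ≡
                                (2 * sl + el) + (2 * (m + d) * suc c + suc c * suc (suc c))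
      regroup = solve-∀
      expand : ∀ l c → (suc c + l) * suc (suc c + l) ≡ l * suc l + (2 * l * suc c + suc c * suc (suc c))
      expand = solve-∀

    deficit-step≡0 : ∀ c d el → el + 2 * d * suc c + suc c * c ≡ 0 ⇔ (el ≡ 0 × d ≡ 0 × c ≡ 0)
    deficit-step≡0 c d el = mk⇔ (vanish c d el) (λ { (refl , refl , refl) → refl })
      where
      vanish : ∀ c d el → el + 2 * d * suc c + suc c * c ≡ 0 → el ≡ 0 × d ≡ 0 × c ≡ 0
      vanish zero zero zero _ = refl , refl , refl
      vanish (suc c) zero zero ()
      vanish c (suc d) zero ()

  sizes-deficit : ∀ m ns → Bounded m ns → DownClosed ns → (m ≡ 0 ⊎ m ∈ ns) →
                  m ≤ length ns × (Unique ns → length ns ≡ m) × SumDeficit ns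
  sizes-deficit zero [] _ _ _ = z≤n , (λ _ → refl) , 0 , refl , mk⇔ (λ _ → []) (λ _ → refl)
  sizes-deficit zero (x ∷ ns) ((1≤x , x≤0) ∷ _) _ _ = ⊥-elim (<-irrefl refl (≤-trans 1≤x x≤0))
  sizes-deficit (suc m) ns bounded closed (inj₁ ())
  sizes-deficit (suc m) ns bounded closed (inj₂ top) = m<|ns| , unique⇒|ns|≡m , e , total , e≡0⇔unique
    where
    open Split m ns bounded closed top
    IH : m ≤ length low × (Unique low → length low ≡ m) × SumDeficit low
    IH = sizes-deficit m low low-bounded low-closed low-top

    c d el e : ℕ
    c = proj₁ top-length
    d = length low ∸ m
    el = proj₁ (proj₂ (proj₂ IH))
    e = el + 2 * d * suc c + suc c * c

    low-total : 2 * sum low + el ≡ length low * suc (length low)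
    low-total = proj₁ (proj₂ (proj₂ (proj₂ IH)))

    el≡0⇔unique : el ≡ 0 ⇔ Unique low
    el≡0⇔unique = proj₂ (proj₂ (proj₂ (proj₂ IH)))

    |low|≡m+d : length low ≡ m + d
    |low|≡m+d = sym (m+[n∸m]≡n (proj₁ IH))

    |ns|≡ : length ns ≡ suc c + (m + d)
    |ns|≡ = trans length-split (cong₂ _+_ (proj₂ top-length) |low|≡m+d)

    m<|ns| : suc m ≤ length ns
    m<|ns| = subst (suc m ≤_) (sym |ns|≡) (+-mono-≤ (s≤s (z≤n {c})) (m≤m+n m d))

    total : 2 * sum ns + e ≡ length ns * suc (length ns)
    total = subst₂' sum-split' |ns|≡
              (deficit-step m c d (sum low) el (subst (λ l → 2 * sum low + el ≡ l * suc l) |low|≡m+d low-total))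
      where
      sum-split' : sum ns ≡ suc m * suc c + sum low
      sum-split' = trans sum-split (cong (λ l → suc m * l + sum low) (proj₂ top-length))
      subst₂' : ∀ {s s' l l'} → s ≡ s' → l ≡ l' → 2 * s' + e ≡ l' * suc l' → 2 * s + e ≡ l * suc l
      subst₂' refl refl h = h

    unique⇒c≡0 : Unique ns → c ≡ 0
    unique⇒c≡0 u = n≤0⇒n≡0 (≤-pred (subst (_≤ 1) (proj₂ top-length)
                     (Unique-constant (suc m) top-part top-constant (filter⁺ (_≟ℕ suc m) u))))

    unique⇒|ns|≡m : Unique ns → length ns ≡ suc m
    unique⇒|ns|≡m u = trans length-split (cong₂ _+_ (trans (proj₂ top-length) (cong suc (unique⇒c≡0 u)))
                                                     (proj₁ (proj₂ IH) (filter⁺ _ u)))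

    e≡0⇔unique : e ≡ 0 ⇔ Unique ns
    e≡0⇔unique = mk⇔ e≡0⇒unique (λ u → from (deficit-step≡0 c d el)
                                      (from el≡0⇔unique (filter⁺ _ u) , d≡0 u , unique⇒c≡0 u))
      where
      e≡0⇒unique : e ≡ 0 → Unique ns
      e≡0⇒unique e≡0 =
        let (el≡0 , _ , c≡0) = to (deficit-step≡0 c d el) e≡0
        in Unique-filter⁻ (_≟ℕ suc m) ns
             (length≤1⇒Unique top-part (subst (_≤ 1) (sym (trans (proj₂ top-length) (cong suc c≡0))) ≤-refl))
             (to el≡0⇔unique el≡0)
      d≡0 : Unique ns → d ≡ 0
      d≡0 u = +-cancelˡ-≡ m d 0 (trans (sym |low|≡m+d) (trans (proj₁ (proj₂ IH) (filter⁺ _ u)) (sym (+-identityʳ m))))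

  sumDeficit : ∀ ns → All (1 ≤_) ns → DownClosed ns → SumDeficit ns
  sumDeficit ns positive closed =
    proj₂ (proj₂ (sizes-deficit (max 0 ns) ns (All.zipWith id (positive , xs≤max 0 ns)) closed (argmax-sel id 0 ns)))

module Trees where

  open import Defs
  open Walks
  open Subsets
  open import Data.Nat using (ℕ)
  open import Data.Bool using ()
  open import Data.Fin using (Fin; _≟_)
  open import Data.Fin.Subset using (Subset) renaming ()
  open import Data.List using ([]; _∷_)
  open import Data.List.Relation.Unary.All as All using (_∷_)
  open import Data.List.Relation.Unary.AllPairs using (_∷_)
  open import Data.Product using (Σ; _×_; _,_; proj₁; proj₂)
  open import Data.Sum using (_⊎_; inj₁; inj₂)
  open import Data.Unit using (⊤)
  open import Data.Empty using (⊥-elim)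
  open import Relation.Nullary using (¬_; Dec; yes; no)
  open import Relation.Binary.PropositionalEquality using (_≡_; refl; sym; trans; subst)

  module TreeProperties {n : ℕ} {T : Graph n} (tree : IsTree T) where

    symmetric : ∀ x y → T x y ≡ T y x
    symmetric = proj₁ tree

    connected : Connected T
    connected = proj₁ (proj₂ (proj₂ (proj₂ tree)))

    acyclic : ¬ Cycle T
    acyclic = proj₂ (proj₂ (proj₂ (proj₂ tree)))

    adj⇒≢ : ∀ {x y} → Adj T x y → ¬ x ≡ y
    adj⇒≢ {x} e refl with trans (sym e) (proj₁ (proj₂ tree) x)
    ... | ()

    module EdgeSide {u v : Fin n} (uv : Adj T u v) where

      Side : Fin n → Set
      Side = CompAvoid T v u

      u≢v : ¬ u ≡ v
      u≢v = adj⇒≢ uv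

      u∈Side : Side u
      u∈Side = stop u≢v

      v∉Side : ¬ Side v
      v∉Side w = walk-end w refl

      -- A second edge from the side into v would close a cycle through uv.
      side-adj-v⇒u : ∀ {w} → Side w → Adj T w v → w ≡ u
      side-adj-v⇒u {w} w∈ wv with w ≟ u
      ... | yes w≡u = w≡u
      ... | no w≢u with walk⇒simple w∈
      ...   | [] , _ , _ , lst , _ = ⊥-elim (w≢u (sym lst))
      ...   | c ∷ rest , uq , ch , lst , avoid-v =
              ⊥-elim (acyclic (v , u , c , rest , All.map (λ z≢v v≡z → z≢v (sym v≡z)) avoid-v ∷ uq ,
                               cons (adj-sym symmetric uv) ch , subst (λ z → Adj T z v) (sym lst) wv))

      private
        walk-via-v : ∀ {y x} → WalkIn T (λ _ → ⊤) y x →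
                     WalkIn T (λ z → ¬ z ≡ v) y x ⊎ (x ≡ v ⊎ Σ (Fin n) λ w → Adj T v w × WalkIn T (λ z → ¬ z ≡ v) w x)
        walk-via-v (stop {x} _) with x ≟ v
        ... | yes x≡v = inj₂ (inj₁ x≡v)
        ... | no x≢v = inj₁ (stop x≢v)
        walk-via-v (step {x = y} {y = y'} _ e w) with walk-via-v w
        ... | inj₂ r = inj₂ r
        ... | inj₁ w' with y ≟ v
        ...   | yes refl = inj₂ (inj₂ (y' , e , w'))
        ...   | no y≢v = inj₁ (step y≢v e w')

      Side? : ∀ x → Dec (Side x)
      Side? x with walk-via-v (connected u x)
      ... | inj₁ w = yes w
      ... | inj₂ (inj₁ refl) = no v∉Side
      ... | inj₂ (inj₂ (w , vw , w⇝x)) with w ≟ u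
      ...   | yes refl = yes w⇝x
      ...   | no w≢u = no (λ x∈ → w≢u (side-adj-v⇒u (walk-++ x∈ (walk-reverse symmetric w⇝x)) (adj-sym symmetric vw)))

      side-edge : ∀ {x y} → Side x → ¬ Side y → Adj T x y → x ≡ u × y ≡ v
      side-edge {x} {y} x∈ y∉ e with y ≟ v
      ... | no y≢v = ⊥-elim (y∉ (walk-++ x∈ (walk-edge (walk-end x∈) y≢v e)))
      ... | yes refl = side-adj-v⇒u x∈ e , refl

      sideSet : Subset n
      sideSet = subsetOf Side?

module Moving where

  open import Defs
  open Walks
  open Subsets
  open Trees
  open import Data.Nat using (ℕ)
  open import Data.Bool using (true; false; _∨_)
  open import Data.Bool.Properties using (∨-zeroʳ)
  open import Data.Fin using (Fin; _≟_)
  open import Data.Fin.Properties using (any?)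
  open import Data.Fin.Subset using (_∪_; ⁅_⁆) renaming (_∈_ to _∈ₛ_; _∉_ to _∉ₛ_)
  open import Data.Fin.Subset.Properties using () renaming (_∈?_ to _∈ₛ?_)
  open import Data.Product using (_×_; _,_; proj₁; proj₂)
  open import Data.Sum using (_⊎_; inj₁; inj₂; [_,_])
  open import Data.Empty using (⊥-elim)
  open import Relation.Nullary using (¬_; ¬?; Dec; yes; no; _×-dec_)
  open import Function.Bundles using (_⇔_; mk⇔)
  open import Relation.Binary.PropositionalEquality using (_≡_; refl; sym; trans; subst; subst₂)

  module _ {n : ℕ} (G : Graph n) (u v : Fin n) where

    private
      G' = moveAdj G u v

      ∨-introˡ : ∀ {a b} → a ≡ true → (a ∨ b) ≡ true
      ∨-introˡ refl = refl

      ∨-introʳ : ∀ {a b} → b ≡ true → (a ∨ b) ≡ true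
      ∨-introʳ {a} refl = ∨-zeroʳ a

      ∨-elim : ∀ a b → (a ∨ b) ≡ true → a ≡ true ⊎ b ≡ true
      ∨-elim true b _ = inj₁ refl
      ∨-elim false b e = inj₂ e

    moved-adj-v⇒u : ∀ y → Adj G' v y → y ≡ u
    moved-adj-v⇒u y e with v ≟ v
    ... | no v≢v = ⊥-elim (v≢v refl)
    ... | yes _ with y ≟ u
    ...   | yes y≡u = y≡u
    ...   | no _ with e
    ...     | ()

    moved-adj-vu : Adj G' v u
    moved-adj-vu with v ≟ v
    ... | no v≢v = ⊥-elim (v≢v refl)
    ... | yes _ with u ≟ u
    ...   | yes _ = refl
    ...   | no u≢u = ⊥-elim (u≢u refl)

    moved-adj-uv : ¬ u ≡ v → Adj G' u v
    moved-adj-uv u≢v with u ≟ v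
    ... | yes u≡v = ⊥-elim (u≢v u≡v)
    ... | no _ with v ≟ v
    ...   | no v≢v = ⊥-elim (v≢v refl)
    ...   | yes _ with u ≟ u
    ...     | yes _ = refl
    ...     | no u≢u = ⊥-elim (u≢u refl)

    moved-adj-kept : (∀ z → G z z ≡ false) → ∀ x y → Adj G x y → ¬ x ≡ v → ¬ y ≡ v → Adj G' x y
    moved-adj-kept loopless x y e x≢v y≢v with x ≟ v | y ≟ v
    ... | yes x≡v | _ = ⊥-elim (x≢v x≡v)
    ... | no _ | yes y≡v = ⊥-elim (y≢v y≡v)
    ... | no _ | no _ with x ≟ u | y ≟ u
    ...   | yes refl | yes refl with trans (sym e) (loopless x)
    ...     | ()
    moved-adj-kept loopless x y e x≢v y≢v | no _ | no _ | yes refl | no _ = ∨-introˡ e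
    moved-adj-kept loopless x y e x≢v y≢v | no _ | no _ | no _ | yes refl = ∨-introˡ e
    moved-adj-kept loopless x y e x≢v y≢v | no _ | no _ | no _ | no _ = e

    moved-adj-from-v : ¬ u ≡ v → ∀ y → Adj G v y → ¬ y ≡ u → ¬ y ≡ v → Adj G' u y
    moved-adj-from-v u≢v y e y≢u y≢v with u ≟ v | y ≟ v
    ... | yes u≡v | _ = ⊥-elim (u≢v u≡v)
    ... | no _ | yes y≡v = ⊥-elim (y≢v y≡v)
    ... | no _ | no _ with u ≟ u | y ≟ u
    ...   | no u≢u | _ = ⊥-elim (u≢u refl)
    ...   | yes _ | yes y≡u = ⊥-elim (y≢u y≡u)
    ...   | yes _ | no _ = ∨-introʳ e

    moved-adj-to-v : ¬ u ≡ v → ∀ x → Adj G x v → ¬ x ≡ u → ¬ x ≡ v → Adj G' x u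
    moved-adj-to-v u≢v x e x≢u x≢v with x ≟ v | u ≟ v
    ... | yes x≡v | _ = ⊥-elim (x≢v x≡v)
    ... | no _ | yes u≡v = ⊥-elim (u≢v u≡v)
    ... | no _ | no _ with x ≟ u | u ≟ u
    ...   | _ | no u≢u = ⊥-elim (u≢u refl)
    ...   | yes x≡u | yes _ = ⊥-elim (x≢u x≡u)
    ...   | no _ | yes _ = ∨-introʳ e

    moved-adj⁻ : Adj G u v → Adj G v u → ∀ x y → Adj G' x y →
                 Adj G x y ⊎ ((x ≡ u × Adj G v y) ⊎ (y ≡ u × Adj G x v))
    moved-adj⁻ uv vu x y e with x ≟ v | y ≟ v
    moved-adj⁻ uv vu x y e | yes refl | _ with y ≟ u
    ... | yes refl = inj₁ vu
    ... | no _ with e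
    ...   | ()
    moved-adj⁻ uv vu x y e | no _ | yes refl with x ≟ u
    ... | yes refl = inj₁ uv
    ... | no _ with e
    ...   | ()
    moved-adj⁻ uv vu x y e | no _ | no _ with x ≟ u | y ≟ u
    ... | yes refl | yes refl = inj₁ e
    ... | yes refl | no _ with ∨-elim (G x y) (G v y) e
    ...   | inj₁ e' = inj₁ e'
    ...   | inj₂ e' = inj₂ (inj₁ (refl , e'))
    moved-adj⁻ uv vu x y e | no _ | no _ | no _ | yes refl with ∨-elim (G x y) (G x v) e
    ...   | inj₁ e' = inj₁ e'
    ...   | inj₂ e' = inj₂ (inj₂ (refl , e'))
    moved-adj⁻ uv vu x y e | no _ | no _ | no _ | no _ = inj₁ e

  module MovedTree {n : ℕ} {T : Graph n} (tree : IsTree T) {u v : Fin n} (uv : Adj T u v) where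

    open TreeProperties tree
    open EdgeSide uv using (u≢v)

    private
      T' = moveAdj T u v
      vu = adj-sym symmetric uv

      merge : ∀ x → Dec (x ≡ v) → Fin n
      merge x (yes _) = u
      merge x (no _) = x

      merge-fix : ∀ {x} → ¬ x ≡ v → merge x (x ≟ v) ≡ x
      merge-fix {x} x≢v with x ≟ v
      ... | yes x≡v = ⊥-elim (x≢v x≡v)
      ... | no _ = refl

    walk-moved⁺ : ∀ {P : Fin n → Set} → P u → ∀ {a b} → WalkIn T P a b →
                  WalkIn T' (λ z → P z × ¬ z ≡ v) (merge a (a ≟ v)) (merge b (b ≟ v))
    walk-moved⁺ {P} Pu = walk-image (λ x → merge x (x ≟ v)) vertex edge
      where
      vertex : ∀ x → P x → P (merge x (x ≟ v)) × ¬ merge x (x ≟ v) ≡ v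
      vertex x px with x ≟ v
      ... | yes _ = Pu , u≢v
      ... | no x≢v = px , x≢v
      edge : ∀ x y → P x → P y → Adj T x y →
             WalkIn T' (λ z → P z × ¬ z ≡ v) (merge x (x ≟ v)) (merge y (y ≟ v))
      edge x y px py e with x ≟ v | y ≟ v
      ... | yes refl | yes refl = ⊥-elim (adj⇒≢ e refl)
      ... | yes refl | no y≢v with y ≟ u
      ...   | yes refl = stop (Pu , u≢v)
      ...   | no y≢u = walk-edge (Pu , u≢v) (py , y≢v) (moved-adj-from-v T u v u≢v y e y≢u y≢v)
      edge x y px py e | no x≢v | yes refl with x ≟ u
      ...   | yes refl = stop (Pu , u≢v)
      ...   | no x≢u = walk-edge (px , x≢v) (Pu , u≢v) (moved-adj-to-v T u v u≢v x e x≢u x≢v)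
      edge x y px py e | no x≢v | no y≢v =
        walk-edge (px , x≢v) (py , y≢v) (moved-adj-kept T u v (proj₁ (proj₂ tree)) x y e x≢v y≢v)

    walk-moved⁻ : ∀ {P : Fin n → Set} → P v → ∀ {a b} → WalkIn T' P a b → WalkIn T P a b
    walk-moved⁻ {P} Pv = walk-image (λ x → x) (λ _ p → p) edge
      where
      edge : ∀ x y → P x → P y → Adj T' x y → WalkIn T P x y
      edge x y px py e with moved-adj⁻ T u v uv vu x y e
      ... | inj₁ e' = walk-edge px py e'
      ... | inj₂ (inj₁ (refl , e')) = step px uv (walk-edge Pv py e')
      ... | inj₂ (inj₂ (refl , e')) = step px e' (walk-edge Pv py vu)

    ConnectedOn-moved-∋uv : ∀ {S} → u ∈ₛ S → v ∈ₛ S → ConnectedOn T S ⇔ ConnectedOn T' S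
    ConnectedOn-moved-∋uv {S} u∈ v∈ = mk⇔ to' (λ c a b a∈ b∈ → walk-moved⁻ v∈ (c a b a∈ b∈))
      where
      enter : ∀ a → a ∈ₛ S → WalkIn T' (_∈ₛ S) a (merge a (a ≟ v))
      enter a a∈ with a ≟ v
      ... | yes refl = walk-edge v∈ u∈ (moved-adj-vu T u v)
      ... | no _ = stop a∈
      leave : ∀ b → b ∈ₛ S → WalkIn T' (_∈ₛ S) (merge b (b ≟ v)) b
      leave b b∈ with b ≟ v
      ... | yes refl = walk-edge u∈ v∈ (moved-adj-uv T u v u≢v)
      ... | no _ = stop b∈
      to' : ConnectedOn T S → ConnectedOn T' S
      to' c a b a∈ b∈ =
        walk-++ (enter a a∈) (walk-++ (walk-map (λ _ → proj₁) (walk-moved⁺ u∈ (c a b a∈ b∈))) (leave b b∈))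

    ConnectedOn-moved-∌v : ∀ {S} → u ∈ₛ S → v ∉ₛ S → ConnectedOn T' S ⇔ ConnectedOn T (S ∪ ⁅ v ⁆)
    ConnectedOn-moved-∌v {S} u∈ v∉ = mk⇔ to' from'
      where
      toU : ConnectedOn T' S → ∀ a → a ∈ₛ S ∪ ⁅ v ⁆ → WalkIn T (_∈ₛ S ∪ ⁅ v ⁆) a u
      toU c a m with x∈p∪⁅y⁆⁻ v S m
      ... | inj₁ a∈ = walk-moved⁻ (x∈p∪⁅x⁆ v S) (walk-map (λ _ → p⊆p∪⁅x⁆ v) (c a u a∈ u∈))
      ... | inj₂ refl = walk-edge (x∈p∪⁅x⁆ v S) (p⊆p∪⁅x⁆ v u∈) vu
      to' : ConnectedOn T' S → ConnectedOn T (S ∪ ⁅ v ⁆)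
      to' c a b a∈ b∈ = walk-++ (toU c a a∈) (walk-reverse symmetric (toU c b b∈))
      from' : ConnectedOn T (S ∪ ⁅ v ⁆) → ConnectedOn T' S
      from' c a b a∈ b∈ =
        subst₂ (WalkIn T' (_∈ₛ S)) (merge-fix (λ { refl → v∉ a∈ })) (merge-fix (λ { refl → v∉ b∈ }))
          (walk-map shrink (walk-moved⁺ (p⊆p∪⁅x⁆ v u∈) (c a b (p⊆p∪⁅x⁆ v a∈) (p⊆p∪⁅x⁆ v b∈))))
        where
        shrink : ∀ z → z ∈ₛ S ∪ ⁅ v ⁆ × ¬ z ≡ v → z ∈ₛ S
        shrink z (m , z≢v) = [ (λ z∈ → z∈) , (λ z≡v → ⊥-elim (z≢v z≡v)) ] (x∈p∪⁅y⁆⁻ v S m)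

    subtree-moved-v : ∀ {S} → SubtreeAt T' v S → S ≡ ⁅ v ⁆ ⊎ u ∈ₛ S
    subtree-moved-v {S} (v∈ , c) with any? (λ a → a ∈ₛ? S ×-dec ¬? (a ≟ v))
    ... | yes (a , a∈ , a≢v) = inj₂ (first-step (c v a v∈ a∈) a≢v)
      where
      first-step : ∀ {a} → WalkIn T' (_∈ₛ S) v a → ¬ a ≡ v → u ∈ₛ S
      first-step (stop _) a≢v = ⊥-elim (a≢v refl)
      first-step (step _ e w) _ = subst (_∈ₛ S) (moved-adj-v⇒u T u v _ e) (walk-start w)
    ... | no none = inj₁ (⁅x⁆≡p v∈ only-v)
      where
      only-v : ∀ {z} → z ∈ₛ S → z ≡ v
      only-v {z} z∈ with z ≟ v
      ... | yes z≡v = z≡v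
      ... | no z≢v = ⊥-elim (none (z , z∈ , z≢v))

module SubtreeCounts where

  open import Defs
  open Walks
  open Subsets
  open Enumerations
  open Trees
  open Moving
  open import Data.Nat using (ℕ; suc; _+_; _*_)
  open import Data.Nat.Properties using (+-assoc; +-identityʳ)
  open import Data.Fin using (Fin)
  open import Data.Fin.Subset using (Subset; _∩_; _∪_; ∁; ⁅_⁆; _-_; _⊆_; ∣_∣) renaming (_∈_ to _∈ₛ_; _∉_ to _∉ₛ_)
  open import Data.Fin.Subset.Properties
    using (x∈p∩q⁺; x∈p∩q⁻; x∈p∪q⁺; x∈p∪q⁻; x∈∁p⇒x∉p; x∉p⇒x∈∁p; ⊆-antisym; x∈⁅x⁆; x∈⁅y⁆⇒x≡y; ∣⁅x⁆∣≡1;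
           x∈p∧x≢y⇒x∈p-y)
    renaming (_∈?_ to _∈ₛ?_)
  open import Data.List using (List; length; map; filter; cartesianProduct)
  open import Data.List.Membership.Propositional using (_∈_)
  open import Data.List.Properties using (length-map)
  open import Data.List.Relation.Binary.Permutation.Propositional using (_↭_)
  open import Data.List.Relation.Binary.Permutation.Propositional.Properties using (↭-length)
  open import Data.Product using (_×_; _,_; proj₁; proj₂; uncurry)
  open import Data.Sum using (inj₁; inj₂; [_,_])
  open import Data.Empty using (⊥-elim)
  open import Function.Bundles using (_⇔_; mk⇔; Equivalence)
  open import Relation.Nullary using (¬_; Dec; yes; no)
  open import Relation.Unary.Properties using (∁?)
  open import Relation.Binary.PropositionalEquality using (_≡_; refl; sym; trans; cong; cong₂; subst)
  open Equivalence using (to; from)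

  SubtreeAtAvoiding : ∀ {n} → Graph n → Fin n → Fin n → Subset n → Set
  SubtreeAtAvoiding G x y S = SubtreeAt G x S × y ∉ₛ S

  avoiding⊆CompAvoid : ∀ {n} {G : Graph n} {x y X} → SubtreeAtAvoiding G x y X →
                       ∀ {z} → z ∈ₛ X → CompAvoid G y x z
  avoiding⊆CompAvoid ((x∈ , conn) , y∉) z∈ = walk-map (λ w w∈ w≡y → y∉ (subst (_∈ₛ _) w≡y w∈)) (conn _ _ x∈ z∈)

  module EdgeSubtrees {n : ℕ} {T : Graph n} (tree : IsTree T) {u v : Fin n} (uv : Adj T u v) where

    open TreeProperties tree
    open EdgeSide uv

    Through : Subset n → Set
    Through S = SubtreeAt T u S × v ∈ₛ S

    private
      ∈sideSet⁺ : ∀ {x} → Side x → x ∈ₛ sideSet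
      ∈sideSet⁺ = ∈-subsetOf⁺ Side?
      ∈sideSet⁻ : ∀ {x} → x ∈ₛ sideSet → Side x
      ∈sideSet⁻ = ∈-subsetOf⁻ Side?

    avoiding-u∩Side : ∀ {Y} → SubtreeAtAvoiding T v u Y → ∀ {y} → y ∈ₛ Y → ¬ Side y
    avoiding-u∩Side ((v∈ , conn) , u∉) y∈ y∈Side with walk-exit Side? (conn _ v y∈ v∈) y∈Side v∉Side
    ... | x , _ , x∈Side , z∉Side , e , x∈ , _ = u∉ (subst (_∈ₛ _) (proj₁ (side-edge x∈Side z∉Side e)) x∈)

    through-∪ : ∀ {X Y} → SubtreeAtAvoiding T u v X → SubtreeAtAvoiding T v u Y → Through (X ∪ Y)
    through-∪ {X} {Y} ((u∈X , connX) , _) ((v∈Y , connY) , _) =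
      (x∈p∪q⁺ (inj₁ u∈X) , λ a b a∈ b∈ → walk-++ (toU a a∈) (walk-reverse symmetric (toU b b∈))) ,
      x∈p∪q⁺ (inj₂ v∈Y)
      where
      inX : ∀ z → z ∈ₛ X → z ∈ₛ X ∪ Y
      inX z m = x∈p∪q⁺ (inj₁ m)
      inY : ∀ z → z ∈ₛ Y → z ∈ₛ X ∪ Y
      inY z m = x∈p∪q⁺ (inj₂ m)
      toU : ∀ a → a ∈ₛ X ∪ Y → WalkIn T (_∈ₛ X ∪ Y) a u
      toU a m with x∈p∪q⁻ X Y m
      ... | inj₁ a∈X = walk-map inX (connX a u a∈X u∈X)
      ... | inj₂ a∈Y = walk-++ (walk-map inY (connY a v a∈Y v∈Y))
                               (walk-edge (inY v v∈Y) (inX u u∈X) (adj-sym symmetric uv))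

    through-∩Side : ∀ {S} → Through S → SubtreeAtAvoiding T u v (S ∩ sideSet)
    through-∩Side {S} ((u∈ , conn) , v∈) =
      (x∈p∩q⁺ (u∈ , ∈sideSet⁺ u∈Side) ,
       ConnectedOn-∩ symmetric conn u∈ (∈sideSet⁺ u∈Side)
         (λ a∈ b∉ e → proj₁ (side-edge (∈sideSet⁻ a∈) (λ b∈ → b∉ (∈sideSet⁺ b∈)) e))) ,
      λ m → v∉Side (∈sideSet⁻ (proj₂ (x∈p∩q⁻ S sideSet m)))

    through-∩∁Side : ∀ {S} → Through S → SubtreeAtAvoiding T v u (S ∩ ∁ sideSet)
    through-∩∁Side {S} ((u∈ , conn) , v∈) =
      (x∈p∩q⁺ (v∈ , v∈∁) ,
       ConnectedOn-∩ symmetric conn v∈ v∈∁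
         (λ a∈ b∉ e → proj₂ (side-edge (∈sideSet⁻ (outside-∁ b∉)) (λ a∈' → x∈∁p⇒x∉p a∈ (∈sideSet⁺ a∈'))
                                        (adj-sym symmetric e)))) ,
      λ m → x∈∁p⇒x∉p (proj₂ (x∈p∩q⁻ S (∁ sideSet) m)) (∈sideSet⁺ u∈Side)
      where
      v∈∁ : v ∈ₛ ∁ sideSet
      v∈∁ = x∉p⇒x∈∁p (λ m → v∉Side (∈sideSet⁻ m))
      outside-∁ : ∀ {b} → b ∉ₛ ∁ sideSet → b ∈ₛ sideSet
      outside-∁ {b} b∉ with b ∈ₛ? sideSet
      ... | yes b∈ = b∈
      ... | no b∉' = ⊥-elim (b∉ (x∉p⇒x∈∁p b∉'))

    ∪-∩Side : ∀ {X Y} → SubtreeAtAvoiding T u v X → SubtreeAtAvoiding T v u Y → (X ∪ Y) ∩ sideSet ≡ X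
    ∪-∩Side {X} {Y} hX hY = ⊆-antisym left right
      where
      left : (X ∪ Y) ∩ sideSet ⊆ X
      left m with x∈p∩q⁻ (X ∪ Y) sideSet m
      ... | z∈ , z∈Side with x∈p∪q⁻ X Y z∈
      ...   | inj₁ z∈X = z∈X
      ...   | inj₂ z∈Y = ⊥-elim (avoiding-u∩Side hY z∈Y (∈sideSet⁻ z∈Side))
      right : X ⊆ (X ∪ Y) ∩ sideSet
      right z∈X = x∈p∩q⁺ (x∈p∪q⁺ (inj₁ z∈X) , ∈sideSet⁺ (avoiding⊆CompAvoid hX z∈X))

    ∪-∩∁Side : ∀ {X Y} → SubtreeAtAvoiding T u v X → SubtreeAtAvoiding T v u Y → (X ∪ Y) ∩ ∁ sideSet ≡ Y
    ∪-∩∁Side {X} {Y} hX hY = ⊆-antisym left right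
      where
      left : (X ∪ Y) ∩ ∁ sideSet ⊆ Y
      left m with x∈p∩q⁻ (X ∪ Y) (∁ sideSet) m
      ... | z∈ , z∉Side with x∈p∪q⁻ X Y z∈
      ...   | inj₁ z∈X = ⊥-elim (x∈∁p⇒x∉p z∉Side (∈sideSet⁺ (avoiding⊆CompAvoid hX z∈X)))
      ...   | inj₂ z∈Y = z∈Y
      right : Y ⊆ (X ∪ Y) ∩ ∁ sideSet
      right z∈Y = x∈p∩q⁺ (x∈p∪q⁺ (inj₂ z∈Y) , x∉p⇒x∈∁p (λ m → avoiding-u∩Side hY z∈Y (∈sideSet⁻ m)))

  module LocalCounts {n : ℕ} {T : Graph n} (tree : IsTree T) {u v : Fin n} (uv : Adj T u v)
    {L₁ L₂ L₃ L₄ : List (Subset n)}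
    (e₁ : Enumerates L₁ (SubtreeAt (moveAdj T u v) v)) (e₂ : Enumerates L₂ (SubtreeAt T u))
    (e₃ : Enumerates L₃ (SubtreeAt T v)) (e₄ : Enumerates L₄ (SubtreeAt (moveAdj T u v) u)) where

    open TreeProperties tree
    open EdgeSide uv
    open EdgeSubtrees tree uv
    open MovedTree tree uv

    private
      v∈? u∈? : ∀ S → Dec (_ ∈ₛ S)
      v∈? S = v ∈ₛ? S
      u∈? S = u ∈ₛ? S

    LU LV : List (Subset n)
    LU = filter (∁? v∈?) L₂
    LV = filter (∁? u∈?) L₃

    eU : Enumerates LU (SubtreeAtAvoiding T u v)
    eU = Enumerates-filter (∁? v∈?) e₂

    eV : Enumerates LV (SubtreeAtAvoiding T v u)
    eV = Enumerates-filter (∁? u∈?) e₃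

    a b sa sb W : ℕ
    a = length LU
    b = length LV
    sa = sizeSum LU
    sb = sizeSum LV
    W = sa * b + sb * a

    private
      LUV : List (Subset n)
      LUV = map (uncurry _∪_) (cartesianProduct LU LV)

      eUV : Enumerates LUV Through
      eUV = Enumerates-⊕ _∪_ eU eV
        (λ hX hY hX' hY' eq → trans (sym (∪-∩Side hX hY)) (trans (cong (_∩ sideSet) eq) (∪-∩Side hX' hY')) ,
                              trans (sym (∪-∩∁Side hX hY)) (trans (cong (_∩ ∁ sideSet) eq) (∪-∩∁Side hX' hY')))
        (λ S h → S ∩ sideSet , S ∩ ∁ sideSet , through-∩Side h , through-∩∁Side h , p≡p∩q∪p∩∁q S sideSet)
        (λ X Y hX hY → through-∪ hX hY)

      through-count : ∀ {L P} → Enumerates L P → (∀ S → P S ⇔ Through S) → length L ≡ a * b × sizeSum L ≡ W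
      through-count {L} eL P⇔ =
        trans (↭-length p) (length-⊕ {L = LU} {M = LV} _∪_) ,
        trans (↭⇒sizeSum≡ p) (sizeSum-⊕ {L = LU} {M = LV} _∪_ (λ X∈ Y∈ → ∣p∪q∣≡∣p∣+∣q∣ _ _ (λ z∈X z∈Y →
          avoiding-u∩Side (to (proj₂ eV _) Y∈) z∈Y (avoiding⊆CompAvoid (to (proj₂ eU _) X∈) z∈X))))
        where
        p : L ↭ LUV
        p = Enumerates-↭ eL eUV P⇔

      split-count : ∀ {Q : Subset n → Set} (Q? : ∀ S → Dec (Q S)) L →
                    length L ≡ length (filter Q? L) + length (filter (∁? Q?) L) ×
                    sizeSum L ≡ sizeSum (filter Q? L) + sizeSum (filter (∁? Q?) L)
      split-count Q? L = length-filter-split Q? L , sum-filter-split Q? ∣_∣ L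

    count-T-u : length L₂ ≡ a * b + a × sizeSum L₂ ≡ W + sa
    count-T-u =
      let (l , s) = split-count v∈? L₂
          (l' , s') = through-count (Enumerates-filter v∈? e₂) (λ S → mk⇔ (λ h → h) (λ h → h))
      in trans l (cong (_+ a) l') , trans s (cong (_+ sa) s')

    count-T-v : length L₃ ≡ a * b + b × sizeSum L₃ ≡ W + sb
    count-T-v =
      let (l , s) = split-count u∈? L₃
          (l' , s') = through-count (Enumerates-filter u∈? e₃)
                        (λ S → mk⇔ (λ ((v∈ , c) , u∈) → (u∈ , c) , v∈) (λ ((u∈ , c) , v∈) → (v∈ , c) , u∈))
      in trans l (cong (_+ b) l') , trans s (cong (_+ sb) s')

    count-T'-v : length L₁ ≡ a * b + 1 × sizeSum L₁ ≡ W + 1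
    count-T'-v =
      let (l , s) = split-count u∈? L₁
          (l' , s') = through-count (Enumerates-filter u∈? e₁)
                        (λ S → mk⇔ (λ ((v∈ , c) , u∈) → (u∈ , from (ConnectedOn-moved-∋uv u∈ v∈) c) , v∈)
                                   (λ ((u∈ , c) , v∈) → (v∈ , to (ConnectedOn-moved-∋uv u∈ v∈) c) , u∈))
          p = Enumerates-↭ (Enumerates-filter (∁? u∈?) e₁) (Enumerates-⁅⁆ ⁅ v ⁆) only-⁅v⁆
      in trans l (cong₂ _+_ l' (↭-length p)) ,
         trans s (cong₂ _+_ s' (trans (↭⇒sizeSum≡ p) (trans (+-identityʳ _) (∣⁅x⁆∣≡1 v))))
      where
      only-⁅v⁆ : ∀ S → (SubtreeAt (moveAdj T u v) v S × u ∉ₛ S) ⇔ (S ≡ ⁅ v ⁆)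
      only-⁅v⁆ S = mk⇔ (λ (h , u∉) → [ (λ eq → eq) , (λ u∈ → ⊥-elim (u∉ u∈)) ] (subtree-moved-v h))
                       (λ { refl → (x∈⁅x⁆ v , ConnectedOn-⁅x⁆ v) , λ m → u≢v (x∈⁅y⁆⇒x≡y v m) })

    count-T'-u : length L₄ ≡ a * b + a * b × sizeSum L₄ + a * b ≡ W + W
    count-T'-u =
      let (l , s) = split-count v∈? L₄
          (l' , s') = through-count (Enumerates-filter v∈? e₄)
                        (λ S → mk⇔ (λ ((u∈ , c) , v∈) → (u∈ , from (ConnectedOn-moved-∋uv u∈ v∈) c) , v∈)
                                   (λ ((u∈ , c) , v∈) → (u∈ , to (ConnectedOn-moved-∋uv u∈ v∈) c) , v∈))
          (l″ , s″) = through-count added-v (λ S → mk⇔ (λ h → h) (λ h → h))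
          |out|≡ab = trans (sym (length-map (_∪ ⁅ v ⁆) out)) l″
      in trans l (cong₂ _+_ l' |out|≡ab) ,
         trans (cong (_+ a * b) s)
         (trans (+-assoc (sizeSum (filter v∈? L₄)) (sizeSum out) (a * b))
                (cong₂ _+_ s' (trans (cong (sizeSum out +_) (sym |out|≡ab))
                              (trans (sym (sizeSum-map-suc (_∪ ⁅ v ⁆) out grows)) s″))))
      where
      out : List (Subset n)
      out = filter (∁? v∈?) L₄
      e-out : Enumerates out (λ S → SubtreeAt (moveAdj T u v) u S × v ∉ₛ S)
      e-out = Enumerates-filter (∁? v∈?) e₄
      grows : ∀ {S} → S ∈ out → ∣ S ∪ ⁅ v ⁆ ∣ ≡ suc ∣ S ∣
      grows {S} m = ∣p∪⁅x⁆∣≡1+∣p∣ S v (proj₂ (to (proj₂ e-out S) m))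
      added-v : Enumerates (map (_∪ ⁅ v ⁆) out) Through
      added-v = Enumerates-map (_∪ ⁅ v ⁆) e-out
        (λ (_ , v∉) (_ , v∉') → ∪⁅x⁆-injective v v∉ v∉')
        (λ S ((u∈ , c) , v∈) →
          let u∈' = x∈p∧x≢y⇒x∈p-y u∈ u≢v
          in S - v
           , ((u∈' , from (ConnectedOn-moved-∌v u∈' (x∉p-x v S)) (subst (ConnectedOn T) (p≡p-x∪⁅x⁆ v∈) c))
             , x∉p-x v S)
           , p≡p-x∪⁅x⁆ v∈)
        (λ S ((u∈ , c) , v∉) → (p⊆p∪⁅x⁆ v u∈ , to (ConnectedOn-moved-∌v u∈ v∉) c) , x∈p∪⁅x⁆ v S)

module Paths where

  open import Defs
  open import Data.Nat using (ℕ)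
  open import Data.Fin using (Fin)
  open import Data.List using (List; []; _∷_)
  open import Data.List.Relation.Unary.Unique.Propositional using ()
  open import Data.List.Relation.Unary.AllPairs using ([]; _∷_)
  open import Data.List.Relation.Unary.All as All using ([]; _∷_)
  open import Data.List.Relation.Unary.All.Properties using (All¬⇒¬Any)
  open import Data.List.Relation.Unary.Any using (here; there)
  open import Data.List.Membership.Propositional using (_∈_; _∉_)
  open import Data.Product using (Σ; _×_; _,_)
  open import Data.Sum using (_⊎_; inj₁; inj₂; [_,_]; map)
  open import Data.Empty using (⊥-elim)
  open import Function.Bundles using (_⇔_; mk⇔; Equivalence)
  open import Relation.Nullary using (¬_)
  open import Relation.Binary.PropositionalEquality using (_≡_; refl; sym; trans; subst)
  open Equivalence using (to; from)

  module _ {A : Set} where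

    Linked : List A → A → A → Set
    Linked L a b = Consec L a b ⊎ Consec L b a

    Consec-∈ˡ : ∀ {L : List A} {a b} → Consec L a b → a ∈ L
    Consec-∈ˡ here = here refl
    Consec-∈ˡ (there c) = there (Consec-∈ˡ c)

    Consec-∈ʳ : ∀ {L : List A} {a b} → Consec L a b → b ∈ L
    Consec-∈ʳ here = there (here refl)
    Consec-∈ʳ (there c) = there (Consec-∈ʳ c)

    Linked-sym : ∀ {L : List A} {a b} → Linked L a b → Linked L b a
    Linked-sym = [ inj₂ , inj₁ ]

    Linked-head : ∀ {x y : A} {r b} → x ∉ (y ∷ r) → Linked (x ∷ y ∷ r) x b ⇔ b ≡ y
    Linked-head {x} {y} {r} x∉ = mk⇔ linked (λ { refl → inj₁ here })
      where
      linked : ∀ {b} → Linked (x ∷ y ∷ r) x b → b ≡ y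
      linked (inj₁ here) = refl
      linked (inj₁ (there c)) = ⊥-elim (x∉ (Consec-∈ˡ c))
      linked (inj₂ here) = ⊥-elim (x∉ (here refl))
      linked (inj₂ (there c)) = ⊥-elim (x∉ (Consec-∈ʳ c))

    Linked-∷⁺ : ∀ {x : A} {L a b} → Linked L a b → Linked (x ∷ L) a b
    Linked-∷⁺ = map there there

    Linked-∷⁻ : ∀ {x : A} {L a b} → ¬ a ≡ x → ¬ b ≡ x → Linked (x ∷ L) a b → Linked L a b
    Linked-∷⁻ a≢x _ (inj₁ here) = ⊥-elim (a≢x refl)
    Linked-∷⁻ _ b≢x (inj₂ here) = ⊥-elim (b≢x refl)
    Linked-∷⁻ _ _ (inj₁ (there c)) = inj₁ c
    Linked-∷⁻ _ _ (inj₂ (there c)) = inj₂ c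

  module _ {n : ℕ} {G : Graph n} where

    PathFrom-resp : ∀ {P P' : Fin n → Set} {x} → (∀ a → P a ⇔ P' a) → PathFrom G P x → PathFrom G P' x
    PathFrom-resp P⇔P' (L , rest , eq , uq , mem , adj) =
      L , rest , eq , uq , (λ a → mk⇔ (λ m → to (P⇔P' a) (to (mem a) m)) (λ p → from (mem a) (from (P⇔P' a) p))) ,
      λ a b pa pb → adj a b (from (P⇔P' a) pa) (from (P⇔P' b) pb)

    PathFrom-single : ∀ {P : Fin n → Set} x → (∀ a → P a ⇔ a ≡ x) → ¬ Adj G x x → PathFrom G P x
    PathFrom-single {P} x P⇔x no-loop = (x ∷ []) , [] , refl , [] ∷ [] ,
      (λ a → mk⇔ (λ { (here refl) → from (P⇔x a) refl }) (λ p → here (to (P⇔x a) p))) ,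
      λ a b pa pb → mk⇔ (λ e → ⊥-elim (no-loop (loop (to (P⇔x a) pa) (to (P⇔x b) pb) e)))
                        (λ { (inj₁ (there ())) ; (inj₂ (there ())) })
      where
      loop : ∀ {a b} → a ≡ x → b ≡ x → Adj G a b → Adj G x x
      loop refl refl e = e

    module _ (symmetric : ∀ x y → G x y ≡ G y x) where

      private
        adj-sym : ∀ {x y} → Adj G x y → Adj G y x
        adj-sym {x} {y} e = trans (symmetric y x) e

      PathFrom-∷ : ∀ {P P' : Fin n → Set} x y → PathFrom G P' y → ¬ P' x →
        Adj G x y → (∀ b → P' b → Adj G x b → b ≡ y) → ¬ Adj G x x →
        (∀ a → P a ⇔ (a ≡ x ⊎ P' a)) → PathFrom G P x
      PathFrom-∷ {P} {P'} x y (.(y ∷ r) , r , refl , uq , mem , adj) x∉P' xy only no-loop P⇔ =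
        (x ∷ y ∷ r) , (y ∷ r) , refl ,
        All.tabulate (λ m x≡ → x∉ (subst (_∈ _) (sym x≡) m)) ∷ uq ,
        (λ a → mk⇔ (λ { (here refl) → from (P⇔ a) (inj₁ refl) ; (there m) → from (P⇔ a) (inj₂ (to (mem a) m)) })
                   (λ p → [ (λ { refl → here refl }) , (λ p' → there (from (mem a) p')) ] (to (P⇔ a) p))) ,
        adj'
        where
        x∉ : x ∉ (y ∷ r)
        x∉ m = x∉P' (to (mem x) m)
        ≢x : ∀ {a} → P' a → ¬ a ≡ x
        ≢x p refl = x∉P' p
        adj' : ∀ a b → P a → P b → Adj G a b ⇔ Linked (x ∷ y ∷ r) a b
        adj' a b pa pb with to (P⇔ a) pa | to (P⇔ b) pb
        ... | inj₁ refl | inj₁ refl =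
              mk⇔ (λ e → ⊥-elim (no-loop e)) (λ l → ⊥-elim (x∉ (here (to (Linked-head x∉) l))))
        ... | inj₁ refl | inj₂ pb' =
              mk⇔ (λ e → from (Linked-head x∉) (only b pb' e))
                  (λ l → subst (Adj G x) (sym (to (Linked-head x∉) l)) xy)
        ... | inj₂ pa' | inj₁ refl =
              mk⇔ (λ e → Linked-sym (from (Linked-head x∉) (only a pa' (adj-sym e))))
                  (λ l → adj-sym (subst (Adj G x) (sym (to (Linked-head x∉) (Linked-sym l))) xy))
        ... | inj₂ pa' | inj₂ pb' =
              mk⇔ (λ e → Linked-∷⁺ (to (adj a b pa' pb') e))
                  (λ l → from (adj a b pa' pb') (Linked-∷⁻ (≢x pa') (≢x pb') l))

    PathFrom-uncons : ∀ {P : Fin n → Set} x → PathFrom G P x →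
      P x × ((∀ a → P a → a ≡ x) ⊎
             Σ (Fin n) λ y → Adj G x y × P y × (∀ b → P b → Adj G x b → b ≡ y) ×
                             PathFrom G (λ a → P a × ¬ a ≡ x) y)
    PathFrom-uncons x (.(x ∷ []) , [] , refl , uq , mem , adj) =
      to (mem x) (here refl) , inj₁ (λ a pa → only-x (from (mem a) pa))
      where
      only-x : ∀ {a} → a ∈ (x ∷ []) → a ≡ x
      only-x (here eq) = eq
    PathFrom-uncons {P} x (.(x ∷ y ∷ r) , y ∷ r , refl , (x∉' ∷ uq) , mem , adj) =
      px , inj₂ (y , xy , py , only ,
        (y ∷ r) , r , refl , uq ,
        (λ a → mk⇔ (λ m → to (mem a) (there m) , (λ { refl → x∉ m }))
                   (λ (pa , a≢x) → tail a≢x (from (mem a) pa))) ,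
        λ a b (pa , a≢x) (pb , b≢x) → mk⇔ (λ e → Linked-∷⁻ a≢x b≢x (to (adj a b pa pb) e))
                                         (λ l → from (adj a b pa pb) (Linked-∷⁺ l)))
      where
      x∉ : x ∉ (y ∷ r)
      x∉ = All¬⇒¬Any x∉'
      px : P x
      px = to (mem x) (here refl)
      py : P y
      py = to (mem y) (there (here refl))
      xy : Adj G x y
      xy = from (adj x y px py) (inj₁ here)
      only : ∀ b → P b → Adj G x b → b ≡ y
      only b pb e = to (Linked-head x∉) (to (adj x b px pb) e)
      tail : ∀ {a} → ¬ a ≡ x → a ∈ (x ∷ y ∷ r) → a ∈ (y ∷ r)
      tail a≢x (here eq) = ⊥-elim (a≢x eq)
      tail a≢x (there m) = m

module Branches where

  open import Defs
  open Walks
  open Subsets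
  open Trees
  open SubtreeCounts
  open Paths
  open import Data.Nat using (ℕ; zero; suc; _≤_; _<_)
  open import Data.Nat.Properties using (≤-trans; ≤-pred; suc-injective)
  open import Data.Bool using (true)
  import Data.Bool.Properties as Bool
  open import Data.Fin using (Fin; _≟_)
  open import Data.Fin.Properties using (any?)
  open import Data.Fin.Subset using (Subset; _∩_; _∪_; ⁅_⁆; ∣_∣) renaming (_∈_ to _∈ₛ_; _∉_ to _∉ₛ_)
  open import Data.Fin.Subset.Properties
    using (⊆-antisym; x∈⁅x⁆; x∈⁅y⁆⇒x≡y; ∣⁅x⁆∣≡1; p⊂q⇒∣p∣<∣q∣; x∈p∩q⁺; x∈p∩q⁻)
    renaming (_∈?_ to _∈ₛ?_)
  open import Data.List using ([]; _∷_)
  open import Data.List.Relation.Unary.All as All using (_∷_)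
  open import Data.List.Relation.Unary.AllPairs using (_∷_)
  open import Data.Product using (Σ; _×_; _,_; proj₁; proj₂)
  open import Data.Sum using (_⊎_; inj₁; inj₂)
  open import Data.Empty using (⊥; ⊥-elim)
  open import Data.Unit using (⊤; tt)
  open import Function.Bundles using (_⇔_; mk⇔; Equivalence)
  open import Relation.Nullary using (¬_; yes; no; ¬?; _×-dec_)
  open import Relation.Binary.PropositionalEquality using (_≡_; refl; sym; trans; cong; subst)
  open Equivalence using (to; from)

  SizesInjective : ∀ {n} → Graph n → Fin n → Fin n → Set
  SizesInjective T u v = ∀ X X' → SubtreeAtAvoiding T u v X → SubtreeAtAvoiding T u v X' → ∣ X ∣ ≡ ∣ X' ∣ → X ≡ X'

  BranchPath : ∀ {n} → Graph n → Fin n → Fin n → Set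
  BranchPath T u v = PathFrom T (CompAvoid T v u) u

  module BranchProperties {n : ℕ} {T : Graph n} (tree : IsTree T) where

    open TreeProperties tree

    module AtEdge {u v : Fin n} (uv : Adj T u v) where

      open EdgeSide uv

      nbr∈Side : ∀ {w} → Adj T u w → ¬ w ≡ v → Side w
      nbr∈Side e w≢v = walk-edge u≢v w≢v e

      leaf⇒Side≡u : (∀ w → Adj T u w → ¬ w ≡ v → ⊥) → ∀ z → Side z → z ≡ u
      leaf⇒Side≡u none z (stop _) = refl
      leaf⇒Side≡u none z (step _ e w) = ⊥-elim (none _ e (walk-start w))

      ⁅u⁆-avoiding : SubtreeAtAvoiding T u v ⁅ u ⁆
      ⁅u⁆-avoiding = (x∈⁅x⁆ u , ConnectedOn-⁅x⁆ u) , λ m → u≢v (sym (x∈⁅y⁆⇒x≡y u m))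

      avoiding≡⁅u⁆ : (∀ z → Side z → z ≡ u) → ∀ {X} → SubtreeAtAvoiding T u v X → X ≡ ⁅ u ⁆
      avoiding≡⁅u⁆ only hX = ⁅x⁆≡p (proj₁ (proj₁ hX)) (λ m → only _ (avoiding⊆CompAvoid hX m))

      edge-avoiding : ∀ {w} → Adj T u w → ¬ w ≡ v → SubtreeAtAvoiding T u v (⁅ u ⁆ ∪ ⁅ w ⁆)
      edge-avoiding {w} uw w≢v =
        (p⊆p∪⁅x⁆ w (x∈⁅x⁆ u) , ConnectedOn-∪⁅x⁆ symmetric (ConnectedOn-⁅x⁆ u) (x∈⁅x⁆ u) uw) , v∉
        where
        v∉ : v ∉ₛ ⁅ u ⁆ ∪ ⁅ w ⁆
        v∉ m with x∈p∪⁅y⁆⁻ w ⁅ u ⁆ m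
        ... | inj₁ m' = u≢v (sym (x∈⁅y⁆⇒x≡y u m'))
        ... | inj₂ v≡w = w≢v (sym v≡w)

      ∣edge∣≡2 : ∀ {w} → Adj T u w → ∣ ⁅ u ⁆ ∪ ⁅ w ⁆ ∣ ≡ 2
      ∣edge∣≡2 {w} uw = trans (∣p∪⁅x⁆∣≡1+∣p∣ ⁅ u ⁆ w (λ m → adj⇒≢ uw (sym (x∈⁅y⁆⇒x≡y u m)))) (cong suc (∣⁅x⁆∣≡1 u))

      -- Two neighbours w, w' ≠ v of u would give two distinct subtrees {u, w}, {u, w'} of size 2.
      injective⇒unique-nbr : SizesInjective T u v → ∀ {w w'} → Adj T u w → ¬ w ≡ v → Adj T u w' → ¬ w' ≡ v → w' ≡ w
      injective⇒unique-nbr inj {w} {w'} uw w≢v uw' w'≢v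
        with x∈p∪⁅y⁆⁻ w ⁅ u ⁆ (subst (w' ∈ₛ_) (sym same) (x∈p∪⁅x⁆ w' ⁅ u ⁆))
        where same = inj _ _ (edge-avoiding uw w≢v) (edge-avoiding uw' w'≢v) (trans (∣edge∣≡2 uw) (sym (∣edge∣≡2 uw')))
      ... | inj₁ m = ⊥-elim (adj⇒≢ uw' (sym (x∈⁅y⁆⇒x≡y u m)))
      ... | inj₂ eq = eq

      -- The side of the edge wu, for a neighbour w ≠ v of u, is the side of uv with u removed
      -- (as soon as w is the only such neighbour).
      module Towards {w : Fin n} (uw : Adj T u w) (w≢v : ¬ w ≡ v) where

        private
          wu = adj-sym symmetric uw
          module W = EdgeSide wu

        W⇒Side : ∀ {z} → W.Side z → Side z × ¬ z ≡ u
        W⇒Side {z} z∈W with Side? z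
        ... | yes z∈ = z∈ , walk-end z∈W
        ... | no z∉ with walk-exit Side? z∈W (nbr∈Side uw w≢v) z∉
        ...   | x , y , x∈ , y∉ , e , x≢u , _ = ⊥-elim (x≢u (proj₁ (side-edge x∈ y∉ e)))

        ∣W∣<∣Side∣ : ∣ W.sideSet ∣ < ∣ sideSet ∣
        ∣W∣<∣Side∣ = p⊂q⇒∣p∣<∣q∣
          ( (λ m → ∈-subsetOf⁺ Side? (proj₁ (W⇒Side (∈-subsetOf⁻ W.Side? m))))
          , u , ∈-subsetOf⁺ Side? u∈Side , (λ m → proj₂ (W⇒Side (∈-subsetOf⁻ W.Side? m)) refl))

        module OnlyNeighbour (only : ∀ w' → Adj T u w' → ¬ w' ≡ v → w' ≡ w) where

          Side⇒W : ∀ {z} → Side z → ¬ z ≡ u → W.Side z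
          Side⇒W {z} z∈ z≢u with walk⇒simple z∈
          ... | [] , _ , _ , lst , _ = ⊥-elim (z≢u (sym lst))
          ... | c ∷ rest , (u∉ ∷ _) , cons e ch , lst , (_ ∷ avoid-v) with only c e (All.head avoid-v)
          ...   | refl = subst W.Side lst (chain⇒walk c rest ch (All.map (λ x≢u x≡u → x≢u (sym x≡u)) u∉))

          Side⇔ : ∀ a → Side a ⇔ (a ≡ u ⊎ W.Side a)
          Side⇔ a = mk⇔ split (λ { (inj₁ refl) → u∈Side ; (inj₂ p) → proj₁ (W⇒Side p) })
            where
            split : Side a → a ≡ u ⊎ W.Side a
            split a∈ with a ≟ u
            ... | yes eq = inj₁ eq
            ... | no a≢u = inj₂ (Side⇒W a∈ a≢u)

          private
            u∉W : ∀ {X} → SubtreeAtAvoiding T w u X → u ∉ₛ X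
            u∉W h m = walk-end (avoiding⊆CompAvoid h m) refl

            lift : ∀ {X} → SubtreeAtAvoiding T w u X → SubtreeAtAvoiding T u v (X ∪ ⁅ u ⁆)
            lift {X} h@((w∈ , c) , _) = (x∈p∪⁅x⁆ u X , ConnectedOn-∪⁅x⁆ symmetric c w∈ wu) , v∉
              where
              v∉ : v ∉ₛ X ∪ ⁅ u ⁆
              v∉ m with x∈p∪⁅y⁆⁻ u X m
              ... | inj₁ m' = v∉Side (proj₁ (W⇒Side (avoiding⊆CompAvoid h m')))
              ... | inj₂ v≡u = u≢v (sym v≡u)

            ∣lift∣ : ∀ {X} → SubtreeAtAvoiding T w u X → ∣ X ∪ ⁅ u ⁆ ∣ ≡ suc ∣ X ∣
            ∣lift∣ {X} h = ∣p∪⁅x⁆∣≡1+∣p∣ X u (u∉W h)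

            peel : ∀ {X} → SubtreeAtAvoiding T u v X →
                   X ≡ ⁅ u ⁆ ⊎ Σ (Subset n) λ X' → SubtreeAtAvoiding T w u X' × X ≡ X' ∪ ⁅ u ⁆
            peel {X} hX@((u∈ , c) , v∉) with any? (λ a → a ∈ₛ? X ×-dec ¬? (a ≟ u))
            ... | no none = inj₁ (⁅x⁆≡p u∈ only-u)
              where
              only-u : ∀ {z} → z ∈ₛ X → z ≡ u
              only-u {z} z∈ with z ≟ u
              ... | yes eq = eq
              ... | no z≢u = ⊥-elim (none (z , z∈ , z≢u))
            ... | yes (a , a∈ , a≢u) = inj₂ (X ∩ W.sideSet , avoiding , X≡)
              where
              first-step : ∀ {a} → WalkIn T (_∈ₛ X) u a → ¬ a ≡ u → w ∈ₛ X
              first-step (stop _) a≢u = ⊥-elim (a≢u refl)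
              first-step (step _ e wk) _ =
                subst (_∈ₛ X) (only _ e (λ { refl → v∉ (walk-start wk) })) (walk-start wk)
              avoiding : SubtreeAtAvoiding T w u (X ∩ W.sideSet)
              avoiding = EdgeSubtrees.through-∩Side tree wu ((first-step (c u a u∈ a∈) a≢u , c) , u∈)
              X≡ : X ≡ (X ∩ W.sideSet) ∪ ⁅ u ⁆
              X≡ = ⊆-antisym split join
                where
                split : ∀ {z} → z ∈ₛ X → z ∈ₛ (X ∩ W.sideSet) ∪ ⁅ u ⁆
                split {z} z∈ with z ≟ u
                ... | yes refl = x∈p∪⁅x⁆ u _
                ... | no z≢u = p⊆p∪⁅x⁆ u (x∈p∩q⁺ (z∈ , ∈-subsetOf⁺ W.Side? (Side⇒W (avoiding⊆CompAvoid hX z∈) z≢u)))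
                join : ∀ {z} → z ∈ₛ (X ∩ W.sideSet) ∪ ⁅ u ⁆ → z ∈ₛ X
                join m with x∈p∪⁅y⁆⁻ u _ m
                ... | inj₁ m' = proj₁ (x∈p∩q⁻ X W.sideSet m')
                ... | inj₂ refl = u∈

            singleton≢lifted : ∀ {X₁ X₂ X'} → X₁ ≡ ⁅ u ⁆ → SubtreeAtAvoiding T w u X' → X₂ ≡ X' ∪ ⁅ u ⁆ →
                               ∣ X₁ ∣ ≡ ∣ X₂ ∣ → ⊥
            singleton≢lifted refl h refl eq with x∈p⇒1≤∣p∣ (proj₁ (proj₁ h))
            ... | 1≤∣X'∣ rewrite suc-injective (sym (trans (sym (∣⁅x⁆∣≡1 u)) (trans eq (∣lift∣ h)))) with 1≤∣X'∣
            ...   | ()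

          injective-down : SizesInjective T u v → SizesInjective T w u
          injective-down inj X₁ X₂ h₁ h₂ eq =
            ∪⁅x⁆-injective u (u∉W h₁) (u∉W h₂)
              (inj _ _ (lift h₁) (lift h₂) (trans (∣lift∣ h₁) (trans (cong suc eq) (sym (∣lift∣ h₂)))))

          injective-up : SizesInjective T w u → SizesInjective T u v
          injective-up inj X₁ X₂ h₁ h₂ eq with peel h₁ | peel h₂
          ... | inj₁ e₁ | inj₁ e₂ = trans e₁ (sym e₂)
          ... | inj₁ e₁ | inj₂ (_ , h₂' , e₂) = ⊥-elim (singleton≢lifted e₁ h₂' e₂ eq)
          ... | inj₂ (_ , h₁' , e₁) | inj₁ e₂ = ⊥-elim (singleton≢lifted e₂ h₁' e₁ (sym eq))
          ... | inj₂ (X₁' , h₁' , e₁) | inj₂ (X₂' , h₂' , e₂) =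
            trans e₁ (trans (cong (_∪ ⁅ u ⁆) (inj _ _ h₁' h₂' (suc-injective ∣X₁'∣+1≡∣X₂'∣+1))) (sym e₂))
            where
            ∣X₁'∣+1≡∣X₂'∣+1 : suc ∣ X₁' ∣ ≡ suc ∣ X₂' ∣
            ∣X₁'∣+1≡∣X₂'∣+1 = trans (sym (∣lift∣ h₁')) (trans (cong ∣_∣ (sym e₁))
                               (trans eq (trans (cong ∣_∣ e₂) (∣lift∣ h₂'))))

          path-up : BranchPath T w u → BranchPath T u v
          path-up p = PathFrom-∷ symmetric u w p (λ m → walk-end m refl) uw
            (λ b b∈ e → only b e (λ { refl → v∉Side (proj₁ (W⇒Side b∈)) })) (λ e → adj⇒≢ e refl) Side⇔

          path-down : PathFrom T (λ a → Side a × ¬ a ≡ u) w → BranchPath T w u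
          path-down = PathFrom-resp (λ a → mk⇔ (λ (a∈ , a≢u) → Side⇒W a∈ a≢u) W⇒Side)

    -- Induction on a bound k for the size of the side of uv, peeling off u.
    injective⇔path : ∀ k {u v} (uv : Adj T u v) → ∣ EdgeSide.sideSet uv ∣ ≤ k →
                     SizesInjective T u v ⇔ BranchPath T u v
    injective⇔path zero uv bound with ≤-trans (x∈p⇒1≤∣p∣ (∈-subsetOf⁺ (EdgeSide.Side? uv) (EdgeSide.u∈Side uv))) bound
    ... | ()
    injective⇔path (suc k) {u} {v} uv bound with any? (λ w → (T u w Bool.≟ true) ×-dec ¬? (w ≟ v))
    ... | no none = mk⇔ (λ _ → PathFrom-single u (λ a → mk⇔ (leaf⇒Side≡u leaf a) (λ { refl → u∈Side }))
                                                   (λ e → adj⇒≢ e refl))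
                        (λ _ X X' h h' _ → trans (avoiding≡⁅u⁆ (leaf⇒Side≡u leaf) h)
                                                 (sym (avoiding≡⁅u⁆ (leaf⇒Side≡u leaf) h')))
      where
      open AtEdge uv
      open EdgeSide uv
      leaf : ∀ w → Adj T u w → ¬ w ≡ v → ⊥
      leaf w e w≢v = none (w , e , w≢v)
    ... | yes (w , uw , w≢v) = mk⇔ injective⇒path path⇒injective
      where
      open AtEdge uv
      open EdgeSide uv
      smaller : ∀ {y} (uy : Adj T u y) (y≢v : ¬ y ≡ v) → ∣ EdgeSide.sideSet (adj-sym symmetric uy) ∣ ≤ k
      smaller uy y≢v = ≤-pred (≤-trans (Towards.∣W∣<∣Side∣ uy y≢v) bound)
      injective⇒path : SizesInjective T u v → BranchPath T u v
      injective⇒path inj = path-up (to (injective⇔path k (adj-sym symmetric uw) (smaller uw w≢v)) (injective-down inj))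
        where open Towards uw w≢v
              open OnlyNeighbour (λ w' e w'≢v → injective⇒unique-nbr inj uw w≢v e w'≢v)
      path⇒injective : BranchPath T u v → SizesInjective T u v
      path⇒injective p with PathFrom-uncons u p
      ... | _ , inj₁ only-u = λ X X' h h' _ → trans (avoiding≡⁅u⁆ only-u h) (sym (avoiding≡⁅u⁆ only-u h'))
      ... | _ , inj₂ (y , uy , y∈ , only , rest) =
        injective-up (from (injective⇔path k (adj-sym symmetric uy) (smaller uy y≢v)) (path-down rest))
        where
        y≢v : ¬ y ≡ v
        y≢v = walk-end y∈
        open Towards uy y≢v
        open OnlyNeighbour (λ w' e w'≢v → only w' (nbr∈Side e w'≢v) e)

    module LeafEnd {u v : Fin n} (uv : Adj T u v) where

      open EdgeSide uv

      v-leaf⇒Side : (∀ w → Adj T v w → w ≡ u) → ∀ z → ¬ z ≡ v → Side z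
      v-leaf⇒Side v-leaf z z≢v with Side? z
      ... | yes z∈ = z∈
      ... | no z∉ with walk-exit (λ c → ¬? (Side? c) ×-dec ¬? (c ≟ v))
                                 (walk-reverse symmetric (connected u z)) (z∉ , z≢v) (λ (u∉ , _) → u∉ u∈Side)
      ...   | a , b , (a∉ , a≢v) , b∉Q , e , _ with b ≟ v | Side? b
      ...     | yes refl | _ = ⊥-elim (a∉ (subst Side (sym (v-leaf a (adj-sym symmetric e))) u∈Side))
      ...     | no b≢v | yes b∈ = ⊥-elim (a≢v (proj₂ (side-edge b∈ a∉ (adj-sym symmetric e))))
      ...     | no b≢v | no b∉ = ⊥-elim (b∉Q (b∉ , b≢v))

      path-from-v⇔ : PathFrom T (λ _ → ⊤) v ⇔ ((∀ w → Adj T v w → w ≡ u) × BranchPath T u v)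
      path-from-v⇔ = mk⇔ split join
        where
        split : PathFrom T (λ _ → ⊤) v → (∀ w → Adj T v w → w ≡ u) × BranchPath T u v
        split p with PathFrom-uncons v p
        ... | _ , inj₁ only-v = ⊥-elim (u≢v (only-v u tt))
        ... | _ , inj₂ (y , vy , _ , only , rest) =
          v-leaf , subst (PathFrom T Side) y≡u
            (PathFrom-resp (λ a → mk⇔ (λ (_ , a≢v) → v-leaf⇒Side v-leaf a a≢v)
                                      (λ a∈ → tt , λ { refl → v∉Side a∈ })) rest)
          where
          y≡u : y ≡ u
          y≡u = sym (only u tt (adj-sym symmetric uv))
          v-leaf : ∀ w → Adj T v w → w ≡ u
          v-leaf w e = trans (only w tt e) y≡u
        join : (∀ w → Adj T v w → w ≡ u) × BranchPath T u v → PathFrom T (λ _ → ⊤) v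
        join (v-leaf , p) =
          PathFrom-∷ symmetric v u p v∉Side (adj-sym symmetric uv) (λ b _ e → v-leaf b e) (λ e → adj⇒≢ e refl)
            (λ a → mk⇔ (λ _ → v-or-side a) (λ _ → tt))
          where
          v-or-side : ∀ a → a ≡ v ⊎ Side a
          v-or-side a with a ≟ v
          ... | yes eq = inj₁ eq
          ... | no a≢v = inj₂ (v-leaf⇒Side v-leaf a a≢v)

module BranchCounting where

  open import Defs
  open Walks
  open Subsets
  open Enumerations
  open SizeLists
  open Trees
  open SubtreeCounts
  open Branches
  open import Data.Nat using (ℕ; zero; suc; _+_; _*_; _∸_; _≤_; _<_; s≤s; z≤n; _≤?_)
  open import Data.Nat.Properties
    using (≤-trans; ≤-pred; n≤0⇒n≡0; +-cancelˡ-≡; ≤-refl; <-irrefl; <⇒≤; ≰⇒>; n≤1+n; +-comm; +-assoc; +-mono-≤; *-suc; m+[n∸m]≡n)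
  open import Data.Fin using (Fin; _≟_)
  open import Data.Fin.Properties using (any?)
  open import Data.Fin.Subset using (Subset; _∪_; ⁅_⁆; _⊆_; ∣_∣) renaming (_∈_ to _∈ₛ_; _∉_ to _∉ₛ_)
  open import Data.Fin.Subset.Properties using (x∈⁅y⁆⇒x≡y; p⊆q⇒∣p∣≤∣q∣; ∣⁅x⁆∣≡1) renaming (_∈?_ to _∈ₛ?_)
  open import Data.List using (List; []; _∷_; length; map)
  open import Data.List.Properties using (length-map)
  open import Data.List.Relation.Unary.All as All using (All)
  open import Data.List.Relation.Unary.AllPairs using (_∷_)
  open import Data.List.Relation.Unary.Unique.Propositional using (Unique)
  open import Data.List.Relation.Unary.Any using (here; there)
  open import Data.List.Membership.Propositional using (_∈_)
  open import Data.List.Membership.Propositional.Properties using (∈-map⁺; ∈-map⁻)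
  open import Data.Product using (Σ; ∃; _×_; _,_; proj₁; proj₂)
  open import Data.Sum using (inj₁; inj₂)
  open import Data.Empty using (⊥-elim)
  open import Function.Bundles using (_⇔_; mk⇔; Equivalence)
  open import Relation.Nullary using (¬_; yes; no; ¬?; _×-dec_)
  open import Relation.Binary.PropositionalEquality using (_≡_; refl; sym; trans; cong; subst; subst₂)
  open import Data.Nat.Tactic.RingSolver using (solve-∀)
  open Equivalence using (to; from)

  module _ {n : ℕ} {T : Graph n} (tree : IsTree T) {x y : Fin n} (xy : Adj T x y) where

    open TreeProperties tree
    open EdgeSide xy
    open BranchProperties tree
    open AtEdge xy

    two≤∣p∣ : ∀ {S : Subset n} {a b} → a ∈ₛ S → b ∈ₛ S → ¬ a ≡ b → 2 ≤ ∣ S ∣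
    two≤∣p∣ {S} {a} {b} a∈ b∈ a≢b =
      subst (_≤ ∣ S ∣) (trans (∣p∪⁅x⁆∣≡1+∣p∣ ⁅ a ⁆ b (λ m → a≢b (sym (x∈⁅y⁆⇒x≡y a m)))) (cong suc (∣⁅x⁆∣≡1 a)))
        (p⊆q⇒∣p∣≤∣q∣ pair⊆)
      where
      pair⊆ : ⁅ a ⁆ ∪ ⁅ b ⁆ ⊆ S
      pair⊆ m with x∈p∪⁅y⁆⁻ b ⁅ a ⁆ m
      ... | inj₁ m' = subst (_∈ₛ S) (sym (x∈⁅y⁆⇒x≡y a m')) a∈
      ... | inj₂ refl = b∈

    ∣p∣≤1⇒⁅x⁆ : ∀ {S} → SubtreeAtAvoiding T x y S → ∣ S ∣ ≤ 1 → S ≡ ⁅ x ⁆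
    ∣p∣≤1⇒⁅x⁆ {S} h ≤1 = ⁅x⁆≡p (proj₁ (proj₁ h)) only-x
      where
      only-x : ∀ {z} → z ∈ₛ S → z ≡ x
      only-x {z} z∈ with z ≟ x
      ... | yes eq = eq
      ... | no z≢x = ⊥-elim (<-irrefl refl (≤-trans (two≤∣p∣ z∈ (proj₁ (proj₁ h)) z≢x) ≤1))

    private
      all-two : ∀ (L : List (Subset n)) → (∀ {S} → S ∈ L → 2 ≤ ∣ S ∣) → 2 * length L ≤ sizeSum L
      all-two [] _ = z≤n
      all-two (S ∷ L) two = subst (_≤ ∣ S ∣ + sizeSum L) (sym (*-suc 2 (length L)))
                              (+-mono-≤ (two (here refl)) (all-two L (λ m → two (there m))))

    -- Apart from {x}, every subtree has at least two vertices.
    2*length≤sizeSum+1 : ∀ (L : List (Subset n)) → Unique L → (∀ {S} → S ∈ L → SubtreeAtAvoiding T x y S) →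
                         2 * length L ≤ sizeSum L + 1
    2*length≤sizeSum+1 [] _ _ = z≤n
    2*length≤sizeSum+1 (S ∷ L) (S∉ ∷ uq) h with ∣ S ∣ ≤? 1
    ... | yes ≤1 = subst₂' (sym (*-suc 2 (length L))) (+-comm 1 (∣ S ∣ + sizeSum L))
                     (+-mono-≤ (s≤s (x∈p⇒1≤∣p∣ (proj₁ (proj₁ (h (here refl)))))) (all-two L two))
      where
      two : ∀ {S'} → S' ∈ L → 2 ≤ ∣ S' ∣
      two {S'} m with ∣ S' ∣ ≤? 1
      ... | no >1 = ≰⇒> >1
      ... | yes ≤1' = ⊥-elim (All.lookup S∉ m (trans (∣p∣≤1⇒⁅x⁆ (h (here refl)) ≤1) (sym (∣p∣≤1⇒⁅x⁆ (h (there m)) ≤1'))))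
      subst₂' : ∀ {p q r s} → p ≡ q → r ≡ s → p ≤ r → q ≤ s
      subst₂' refl refl le = le
    ... | no >1 = subst (_≤ (∣ S ∣ + sizeSum L) + 1) (sym (*-suc 2 (length L)))
                    (subst (2 + 2 * length L ≤_) (sym (+-assoc ∣ S ∣ (sizeSum L) 1))
                      (+-mono-≤ (≰⇒> >1) (2*length≤sizeSum+1 L uq (λ m → h (there m)))))

    -- A subtree can be grown from {x} one vertex at a time inside any larger subtree.
    avoiding-of-size : ∀ {X} → SubtreeAtAvoiding T x y X → ∀ k → 1 ≤ k → k ≤ ∣ X ∣ →
                       Σ (Subset n) λ X' → SubtreeAtAvoiding T x y X' × X' ⊆ X × ∣ X' ∣ ≡ k
    avoiding-of-size {X} h (suc zero) _ _ = ⁅ x ⁆ , ⁅u⁆-avoiding , ⁅x⁆⊆p (proj₁ (proj₁ h)) , ∣⁅x⁆∣≡1 x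
    avoiding-of-size {X} h (suc (suc k)) _ k≤
      with avoiding-of-size h (suc k) (s≤s z≤n) (≤-trans (n≤1+n _) k≤)
    ... | X' , h' , X'⊆ , ∣X'∣≡ with any? (λ t → t ∈ₛ? X ×-dec ¬? (t ∈ₛ? X'))
    ...   | no none = ⊥-elim (<-irrefl refl (≤-trans k≤ (subst (∣ X ∣ ≤_) ∣X'∣≡ (p⊆q⇒∣p∣≤∣q∣ X⊆X'))))
      where
      X⊆X' : X ⊆ X'
      X⊆X' {t} t∈ with t ∈ₛ? X'
      ... | yes m = m
      ... | no m = ⊥-elim (none (t , t∈ , m))
    ...   | yes (t , t∈X , t∉X')
      with walk-exit (_∈ₛ? X') (proj₂ (proj₁ h) x t (proj₁ (proj₁ h)) t∈X) (proj₁ (proj₁ h')) t∉X'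
    ...     | z , z' , z∈X' , z'∉X' , e , _ , z'∈X =
      X' ∪ ⁅ z' ⁆ , ((p⊆p∪⁅x⁆ z' (proj₁ (proj₁ h')) , ConnectedOn-∪⁅x⁆ symmetric (proj₂ (proj₁ h')) z∈X' e) , y∉) ,
      ⊆X , trans (∣p∪⁅x⁆∣≡1+∣p∣ X' z' z'∉X') (cong suc ∣X'∣≡)
      where
      y∉ : y ∉ₛ X' ∪ ⁅ z' ⁆
      y∉ m with x∈p∪⁅y⁆⁻ z' X' m
      ... | inj₁ m' = proj₂ h' m'
      ... | inj₂ refl = proj₂ h z'∈X
      ⊆X : X' ∪ ⁅ z' ⁆ ⊆ X
      ⊆X m with x∈p∪⁅y⁆⁻ z' X' m
      ... | inj₁ m' = X'⊆ m'
      ... | inj₂ refl = z'∈X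

  record BranchCounts {n} (T : Graph n) (x y : Fin n) (L : List (Subset n)) : Set where
    field
      a' f e : ℕ
      length≡ : length L ≡ suc a'
      sizeSum≡ : sizeSum L ≡ 2 * a' + 1 + f
      deficit : 2 * sizeSum L + e ≡ length L * suc (length L)
      e≡0⇔path : e ≡ 0 ⇔ BranchPath T x y
      a'≡0⇔leaf : a' ≡ 0 ⇔ (∀ w → Adj T x w → w ≡ y)

  branchCounts : ∀ {n} {T : Graph n} (tree : IsTree T) {x y : Fin n} (xy : Adj T x y) {L} →
                 Enumerates L (SubtreeAtAvoiding T x y) → BranchCounts T x y L
  branchCounts {n} {T} tree {x} {y} xy {L} (uq , mem) = record
    { a' = a'
    ; f = sizeSum L ∸ (2 * a' + 1)
    ; e = proj₁ deficit
    ; length≡ = length≡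
    ; sizeSum≡ = sym (m+[n∸m]≡n lower-bound)
    ; deficit = subst (λ l → 2 * sizeSum L + proj₁ deficit ≡ l * suc l) (length-map ∣_∣ L) (proj₁ (proj₂ deficit))
    ; e≡0⇔path = mk⇔ (λ e≡0 → to injective⇔path' (from injective⇔unique (to (proj₂ (proj₂ deficit)) e≡0)))
                     (λ p → from (proj₂ (proj₂ deficit)) (to injective⇔unique (from injective⇔path' p)))
    ; a'≡0⇔leaf = mk⇔ one⇒leaf leaf⇒one
    }
    where
    open TreeProperties tree
    open EdgeSide xy
    open BranchProperties tree
    open AtEdge xy

    in-L : ∀ {S} → SubtreeAtAvoiding T x y S → S ∈ L
    in-L h = from (mem _) h
    of-L : ∀ {S} → S ∈ L → SubtreeAtAvoiding T x y S
    of-L m = to (mem _) m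

    sizes : List ℕ
    sizes = map ∣_∣ L

    sizes-positive : All (1 ≤_) sizes
    sizes-positive = All.tabulate λ m → positive (∈-map⁻ ∣_∣ m)
      where
      positive : ∀ {k} → (∃ λ X → X ∈ L × k ≡ ∣ X ∣) → 1 ≤ k
      positive (X , m , refl) = x∈p⇒1≤∣p∣ (proj₁ (proj₁ (of-L m)))

    sizes-closed : DownClosed sizes
    sizes-closed m k 1≤k k< = smaller (∈-map⁻ ∣_∣ m) 1≤k k<
      where
      smaller : ∀ {k s} → (∃ λ X → X ∈ L × s ≡ ∣ X ∣) → 1 ≤ k → k < s → k ∈ sizes
      smaller {k} (X , m , refl) 1≤k k< with avoiding-of-size tree xy (of-L m) k 1≤k (<⇒≤ k<)
      ... | X' , h' , _ , ∣X'∣≡k = subst (_∈ sizes) ∣X'∣≡k (∈-map⁺ ∣_∣ (in-L h'))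

    deficit : SumDeficit sizes
    deficit = sumDeficit sizes sizes-positive sizes-closed

    injective⇔unique : SizesInjective T x y ⇔ Unique sizes
    injective⇔unique = mk⇔ (λ inj → Unique-map⁺ ∣_∣ (λ m m' eq → inj _ _ (of-L m) (of-L m') eq) uq)
                           (λ u X X' h h' eq → Unique-map⁻ ∣_∣ L u (in-L h) (in-L h') eq)

    injective⇔path' : SizesInjective T x y ⇔ BranchPath T x y
    injective⇔path' = injective⇔path (∣ sideSet ∣) xy ≤-refl

    a'-and-length : Σ ℕ λ a' → length L ≡ suc a'
    a'-and-length = nonempty L (in-L ⁅u⁆-avoiding)
      where
      nonempty : ∀ (M : List (Subset n)) {S} → S ∈ M → Σ ℕ λ k → length M ≡ suc k
      nonempty (_ ∷ M) _ = length M , refl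

    a' : ℕ
    a' = proj₁ a'-and-length

    length≡ : length L ≡ suc a'
    length≡ = proj₂ a'-and-length

    lower-bound : 2 * a' + 1 ≤ sizeSum L
    lower-bound = subst (_≤ sizeSum L) (+-comm 1 (2 * a'))
      (≤-pred (subst₂' (*-suc 2 a') (+-comm (sizeSum L) 1)
        (subst (λ l → 2 * l ≤ sizeSum L + 1) length≡ (2*length≤sizeSum+1 tree xy L uq of-L))))
      where
      subst₂' : ∀ {p q r s} → p ≡ q → r ≡ s → p ≤ r → q ≤ s
      subst₂' refl refl le = le

    one⇒leaf : a' ≡ 0 → ∀ w → Adj T x w → w ≡ y
    one⇒leaf a'≡0 w e with w ≟ y
    ... | yes eq = eq
    ... | no w≢y with ∣edge∣≡2 e | same (in-L ⁅u⁆-avoiding) (in-L (edge-avoiding e w≢y))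
      where
      singleton-list : ∀ (M : List (Subset n)) {S S'} → length M ≡ 1 → S ∈ M → S' ∈ M → S ≡ S'
      singleton-list (_ ∷ []) _ (here refl) (here refl) = refl
      same : ∀ {S S'} → S ∈ L → S' ∈ L → S ≡ S'
      same = singleton-list L (trans length≡ (cong suc a'≡0))
    ...   | ∣pair∣≡2 | ⁅x⁆≡pair with trans (sym (∣⁅x⁆∣≡1 x)) (trans (cong ∣_∣ ⁅x⁆≡pair) ∣pair∣≡2)
    ...     | ()

    leaf⇒one : (∀ w → Adj T x w → w ≡ y) → a' ≡ 0
    leaf⇒one leaf = n≤0⇒n≡0 (≤-pred (subst (_≤ 1) length≡
      (Unique-constant ⁅ x ⁆ L (All.tabulate (λ m → avoiding≡⁅u⁆ only-x (of-L m))) uq)))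
      where
      only-x : ∀ z → Side z → z ≡ x
      only-x = leaf⇒Side≡u (λ w e w≢y → w≢y (leaf w e))

  trivial-branch : ∀ {n} {T : Graph n} {x y L} (B : BranchCounts T x y L) →
                   BranchCounts.a' B ≡ 0 → BranchCounts.f B ≡ 0 × BranchCounts.e B ≡ 0
  trivial-branch {L = L} B a'≡0 = vanish f e (+-cancelˡ-≡ 2 (2 * f + e) 0 (trans (regroup f e) two≡))
    where
    open BranchCounts B
    two≡ : 2 * suc f + e ≡ 2
    two≡ = subst₂ (λ s l → 2 * s + e ≡ l * suc l) (trans sizeSum≡ (cong (λ a → 2 * a + 1 + f) a'≡0))
                                                  (trans length≡ (cong suc a'≡0)) deficit
    regroup : ∀ f e → 2 + (2 * f + e) ≡ 2 * suc f + e
    regroup = solve-∀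
    vanish : ∀ f e → 2 * f + e ≡ 0 → f ≡ 0 × e ≡ 0
    vanish zero zero _ = refl , refl

module Means where

  open import Defs
  open Enumerations using (sizeSum)
  open import Data.Nat using (ℕ; suc; _+_; _*_; NonZero) renaming (_≤_ to _≤ℕ_)
  open import Data.Nat.Properties using (*-cancelˡ-≤; *-cancelˡ-≡; +-cancelˡ-≡; +-identityʳ; m≤m+n)
  open import Data.Integer using (+_; +≤+)
  import Data.Integer as ℤ
  open import Data.Integer.Properties using (pos-*)
  open import Data.Rational using (_/_; _≤_)
  open import Data.Rational.Properties using (toℚᵘ-cancel-≤; toℚᵘ-fromℚᵘ; fromℚᵘ-cong; normalize-injective-≃)
  open import Data.Rational.Unnormalised using (mkℚᵘ; *≤*; *≡*)
  open import Data.Rational.Unnormalised.Properties using (≤-respˡ-≃; ≤-respʳ-≃; ≃-sym)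
  open import Data.Fin.Subset using (Subset)
  open import Data.List using (List; []; _∷_; length)
  open import Data.Product using (_×_; _,_)
  open import Function.Bundles using (_⇔_; mk⇔; Equivalence)
  open Equivalence using (to; from)
  open import Relation.Binary.PropositionalEquality using (_≡_; refl; sym; trans; cong; subst; subst₂)

  /-≤ : ∀ p k q l → p * suc l ≤ℕ q * suc k → (+ p / suc k) ≤ (+ q / suc l)
  /-≤ p k q l h = toℚᵘ-cancel-≤ (≤-respˡ-≃ (≃-sym (toℚᵘ-fromℚᵘ (mkℚᵘ (+ p) k)))
                   (≤-respʳ-≃ (≃-sym (toℚᵘ-fromℚᵘ (mkℚᵘ (+ q) l)))
                   (*≤* {mkℚᵘ (+ p) k} {mkℚᵘ (+ q) l} (subst₂ ℤ._≤_ (pos-* p (suc l)) (pos-* q (suc k)) (+≤+ h)))))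

  /-≡⇔ : ∀ p k q l → (+ p / suc k) ≡ (+ q / suc l) ⇔ (p * suc l ≡ q * suc k)
  /-≡⇔ p k q l = mk⇔ (normalize-injective-≃ p q (suc k) (suc l))
    (λ h → fromℚᵘ-cong {mkℚᵘ (+ p) k} {mkℚᵘ (+ q) l} (*≡* (trans (sym (pos-* p (suc l))) (trans (cong +_ h) (pos-* q (suc k))))))

  mean-compare : ∀ {n} (L L' : List (Subset n)) {S N S' N'} (m : ℕ) .{{_ : NonZero m}} (D : ℕ) →
    sizeSum L ≡ S → length L ≡ N → sizeSum L' ≡ S' → length L' ≡ N' → 1 ≤ℕ N → 1 ≤ℕ N' →
    m * (S' * N) ≡ m * (S * N') + D →
    meanOrder L ≤ meanOrder L' × (meanOrder L' ≡ meanOrder L ⇔ D ≡ 0)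
  mean-compare [] _ _ _ _ refl _ _ () _ _
  mean-compare (_ ∷ _) [] _ _ _ _ _ refl _ () _
  mean-compare (S₀ ∷ L) (S₀' ∷ L') m D refl refl refl refl _ _ identity =
    /-≤ p k q l (*-cancelˡ-≤ m (subst (m * (p * suc l) ≤ℕ_) (sym identity) (m≤m+n _ D))) ,
    mk⇔ (λ eq → +-cancelˡ-≡ (m * (p * suc l)) D 0 (trans (sym identity)
                   (trans (cong (m *_) (to (/-≡⇔ q l p k) eq)) (sym (+-identityʳ _)))))
        (λ D≡0 → from (/-≡⇔ q l p k) (*-cancelˡ-≡ _ _ m
                   (trans identity (trans (cong (_+_ (m * (p * suc l))) D≡0) (+-identityʳ _)))))
    where
    p q k l : ℕ
    p = sizeSum (S₀ ∷ L)
    q = sizeSum (S₀' ∷ L')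
    k = length L
    l = length L'

module MeanComparison where

  open import Defs
  open Walks
  open Enumerations
  open Trees
  open SubtreeCounts
  open Branches
  open BranchCounting
  open Means
  open import Data.Nat using (ℕ; zero; suc; _+_; _*_; s≤s; z≤n) renaming (_≤_ to _≤ℕ_)
  open import Data.Nat.Properties using (+-cancelʳ-≡; *-zeroʳ; *-identityˡ; ≤-trans; m≤n+m; *-mono-≤)
  open import Data.Nat.Tactic.RingSolver using (solve-∀)
  open import Data.Fin using (Fin)
  open import Data.Fin.Subset using (Subset)
  open import Data.List using (List; length)
  open import Data.Rational using (ℚ; _≤_)
  open import Data.Product using (_×_; _,_; proj₁; proj₂)
  open import Data.Sum using (_⊎_; inj₁; inj₂)
  open import Data.Unit using (⊤)
  open import Function.Bundles using (_⇔_; mk⇔; Equivalence)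
  open import Relation.Binary.PropositionalEquality using (_≡_; refl; sym; trans; cong; subst; module ≡-Reasoning)
  open import Function.Properties.Equivalence using () renaming (trans to ⇔-trans)
  open Equivalence using (to; from)

  -- a, b count the subtrees on the two sides of uv and sa, sb are their total orders (see
  -- LocalCounts); 2 sa + e = a(a + 1) and sb = 2 b' + 1 + f come from BranchCounts.
  first-identity : ∀ {a b sa sb} a' b' f e → a ≡ suc a' → b ≡ suc b' → sb ≡ 2 * b' + 1 + f →
    2 * sa + e ≡ a * suc a →
    2 * ((sa * b + sb * a + 1) * (a * b + a)) ≡
    2 * ((sa * b + sb * a + sa) * (a * b + 1)) + (e * suc (suc b') + (3 * b' + 2 * f) * suc a' * a')
  first-identity {sa = sa} a' b' f e refl refl refl deficit =
    +-cancelʳ-≡ ((suc a' * suc (suc a')) * suc (suc b')) _ _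
      (trans (cong (λ t → 2 * (((sa * suc b' + (2 * b' + 1 + f) * suc a') + 1) * (suc a' * suc b' + suc a')) + t * suc (suc b'))
                   (sym deficit))
             (expand a' b' f sa e))
    where
    expand : ∀ a' b' f sa e →
      2 * (((sa * suc b' + (2 * b' + 1 + f) * suc a') + 1) * (suc a' * suc b' + suc a')) + (2 * sa + e) * suc (suc b') ≡
      (2 * (((sa * suc b' + (2 * b' + 1 + f) * suc a') + sa) * (suc a' * suc b' + 1)) +
        (e * suc (suc b') + (3 * b' + 2 * f) * suc a' * a')) + (suc a' * suc (suc a')) * suc (suc b')
    expand = solve-∀

  second-identity : ∀ {a b sa sb S} e → 2 * sa + e ≡ a * suc a → S + a * b ≡ (sa * b + sb * a) + (sa * b + sb * a) →
    1 * ((sa * b + sb * a + sb) * (a * b + a * b)) ≡ 1 * (S * (a * b + b)) + b * b * e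
  second-identity {a} {b} {sa} {sb} {S} e deficit S≡ = trans (*-identityˡ _) (trans
    (+-cancelʳ-≡ ((a * b) * (a * b + b)) _ _ (+-cancelʳ-≡ (b * b * (a * suc a)) _ _ (begin
      (W + sb) * (a * b + a * b) + (a * b) * (a * b + b) + b * b * (a * suc a)
        ≡⟨ cong (λ t → (W + sb) * (a * b + a * b) + (a * b) * (a * b + b) + b * b * t) (sym deficit) ⟩
      (W + sb) * (a * b + a * b) + (a * b) * (a * b + b) + b * b * (2 * sa + e)
        ≡⟨ expand a b sa sb e ⟩
      (W + W) * (a * b + b) + b * b * e + b * b * (a * suc a)
        ≡⟨ cong (λ t → t * (a * b + b) + b * b * e + b * b * (a * suc a)) (sym S≡) ⟩
      (S + a * b) * (a * b + b) + b * b * e + b * b * (a * suc a)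
        ≡⟨ cong (_+ b * b * (a * suc a)) (regroup S (a * b) (a * b + b) (b * b * e)) ⟩
      S * (a * b + b) + b * b * e + (a * b) * (a * b + b) + b * b * (a * suc a) ∎)))
    (cong (_+ b * b * e) (sym (*-identityˡ _))))
    where
    open ≡-Reasoning
    W = sa * b + sb * a
    expand : ∀ a b sa sb e →
      (sa * b + sb * a + sb) * (a * b + a * b) + (a * b) * (a * b + b) + b * b * (2 * sa + e) ≡
      ((sa * b + sb * a) + (sa * b + sb * a)) * (a * b + b) + b * b * e + b * b * (a * suc a)
    expand = solve-∀
    regroup : ∀ s p q r → (s + p) * q + r ≡ s * q + r + p * q
    regroup = solve-∀

  first-defect≡0 : ∀ e b' f a' → e * suc (suc b') + (3 * b' + 2 * f) * suc a' * a' ≡ 0 ⇔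
                   (e ≡ 0 × (a' ≡ 0 ⊎ (b' ≡ 0 × f ≡ 0)))
  first-defect≡0 e b' f a' = mk⇔ (vanish e b' f a') vanishes
    where
    vanish : ∀ e b' f a' → e * suc (suc b') + (3 * b' + 2 * f) * suc a' * a' ≡ 0 → e ≡ 0 × (a' ≡ 0 ⊎ (b' ≡ 0 × f ≡ 0))
    vanish zero b' f zero _ = refl , inj₁ refl
    vanish zero zero zero (suc a') _ = refl , inj₂ (refl , refl)
    vanishes : e ≡ 0 × (a' ≡ 0 ⊎ (b' ≡ 0 × f ≡ 0)) → e * suc (suc b') + (3 * b' + 2 * f) * suc a' * a' ≡ 0
    vanishes (refl , inj₁ refl) = *-zeroʳ ((3 * b' + 2 * f) * 1)
    vanishes (refl , inj₂ (refl , refl)) = refl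

  square*e≡0⇔e≡0 : ∀ {b} e → 1 ≤ℕ b → b * b * e ≡ 0 ⇔ e ≡ 0
  square*e≡0⇔e≡0 {suc b} e _ = mk⇔ (vanish e) (λ { refl → *-zeroʳ (suc b * suc b) })
    where
    vanish : ∀ e → suc b * suc b * e ≡ 0 → e ≡ 0
    vanish zero _ = refl

  IsLeaf⇔ : ∀ {n} {G : Graph n} {u v} → Adj G u v → IsLeaf G u ⇔ (∀ w → Adj G u w → w ≡ v)
  IsLeaf⇔ uv = mk⇔ (λ (w , _ , only) w' e → trans (only w' e) (sym (only _ uv))) (λ only → _ , uv , only)

  module LocalMeans {n : ℕ} {T : Graph n} (tree : IsTree T) {u v : Fin n} (uv : Adj T u v)
    {L₁ L₂ L₃ L₄ : List (Subset n)}
    (e₁ : Enumerates L₁ (SubtreeAt (moveAdj T u v) v)) (e₂ : Enumerates L₂ (SubtreeAt T u))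
    (e₃ : Enumerates L₃ (SubtreeAt T v)) (e₄ : Enumerates L₄ (SubtreeAt (moveAdj T u v) u)) where

    open TreeProperties tree using (symmetric)
    open LocalCounts tree uv e₁ e₂ e₃ e₄
    module U = BranchCounts (branchCounts tree uv eU)
    module V = BranchCounts (branchCounts tree (adj-sym symmetric uv) eV)

    private
      1≤a : 1 ≤ℕ a
      1≤a = subst (1 ≤ℕ_) (sym U.length≡) (s≤s z≤n)
      1≤b : 1 ≤ℕ b
      1≤b = subst (1 ≤ℕ_) (sym V.length≡) (s≤s z≤n)

    private
      D₁ : ℕ
      D₁ = U.e * suc (suc V.a') + (3 * V.a' + 2 * V.f) * suc U.a' * U.a'

      first-comparison : meanOrder L₂ ≤ meanOrder L₁ × (meanOrder L₁ ≡ meanOrder L₂ ⇔ D₁ ≡ 0)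
      first-comparison = mean-compare L₂ L₁ 2 D₁
        (proj₂ count-T-u) (proj₁ count-T-u) (proj₂ count-T'-v) (proj₁ count-T'-v)
        (≤-trans 1≤a (m≤n+m a (a * b))) (m≤n+m 1 (a * b))
        (first-identity {a = a} {b} {sa} {sb} U.a' V.a' V.f U.e U.length≡ V.length≡ V.sizeSum≡ U.deficit)

      second-comparison : meanOrder L₄ ≤ meanOrder L₃ × (meanOrder L₃ ≡ meanOrder L₄ ⇔ b * b * U.e ≡ 0)
      second-comparison = mean-compare L₄ L₃ 1 (b * b * U.e) refl (proj₁ count-T'-u) (proj₂ count-T-v) (proj₁ count-T-v)
        (≤-trans (*-mono-≤ 1≤a 1≤b) (m≤n+m (a * b) (a * b))) (≤-trans 1≤b (m≤n+m b (a * b)))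
        (second-identity {a = a} {b} {sa} {sb} U.e U.deficit (proj₂ count-T'-u))

      leaf-or-path : (U.e ≡ 0 × (U.a' ≡ 0 ⊎ (V.a' ≡ 0 × V.f ≡ 0))) ⇔ (IsLeaf T u ⊎ PathFrom T (λ _ → ⊤) v)
      leaf-or-path = mk⇔
        (λ { (_ , inj₁ a'≡0) → inj₁ (from (IsLeaf⇔ {G = T} uv) (to U.a'≡0⇔leaf a'≡0))
           ; (e≡0 , inj₂ (b'≡0 , _)) → inj₂ (from path-from-v⇔ (to V.a'≡0⇔leaf b'≡0 , to U.e≡0⇔path e≡0)) })
        (λ { (inj₁ leaf) → let a'≡0 = from U.a'≡0⇔leaf (to (IsLeaf⇔ {G = T} uv) leaf)
                           in proj₂ (trivial-branch (branchCounts tree uv eU) a'≡0) , inj₁ a'≡0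
           ; (inj₂ p) → let (v-leaf , path) = to path-from-v⇔ p
                            b'≡0 = from V.a'≡0⇔leaf v-leaf
                        in from U.e≡0⇔path path
                           , inj₂ (b'≡0 , proj₁ (trivial-branch (branchCounts tree (adj-sym symmetric uv) eV) b'≡0)) })
        where open BranchProperties.LeafEnd tree uv using (path-from-v⇔)

    T-u≤T'-v : meanOrder L₂ ≤ meanOrder L₁ × (meanOrder L₁ ≡ meanOrder L₂ ⇔ (IsLeaf T u ⊎ PathFrom T (λ _ → ⊤) v))
    T-u≤T'-v = proj₁ first-comparison ,
               ⇔-trans (proj₂ first-comparison) (⇔-trans (first-defect≡0 U.e V.a' V.f U.a') leaf-or-path)

    T'-u≤T-v : meanOrder L₄ ≤ meanOrder L₃ × (meanOrder L₃ ≡ meanOrder L₄ ⇔ BranchPath T u v)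
    T'-u≤T-v = proj₁ second-comparison ,
               ⇔-trans (proj₂ second-comparison) (⇔-trans (square*e≡0⇔e≡0 U.e 1≤b) U.e≡0⇔path)

open import Defs
open import Data.Nat using (ℕ)
open import Data.Fin using (Fin)
open import Data.Rational using (ℚ; _≤_)
open import Data.Product using (_×_; _,_; proj₁; proj₂)
open import Data.Sum using (_⊎_)
open import Data.Unit using (⊤)
open import Relation.Binary.PropositionalEquality using (_≡_; refl)
open import Function.Bundles using (_⇔_)
open MeanComparison using (module LocalMeans)

theorem3p2 : ∀ {n} (T : Graph n) (u v : Fin n) → IsTree T → Adj T u v →
    ∀ (μT'v μTu μTv μT'u : ℚ) →
    IsLocalMean (moveAdj T u v) v μT'v → IsLocalMean T u μTu →
    IsLocalMean T v μTv → IsLocalMean (moveAdj T u v) u μT'u →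
    (μTu ≤ μT'v) × (μT'u ≤ μTv)
    × ((μT'v ≡ μTu) ⇔ (IsLeaf T u ⊎ PathFrom T (λ _ → ⊤) v))
    × ((μTv ≡ μT'u) ⇔ PathFrom T (CompAvoid T v u) u)
theorem3p2 T u v tree uv _ _ _ _ (_ , e₁ , refl) (_ , e₂ , refl) (_ , e₃ , refl) (_ , e₄ , refl) =
  proj₁ T-u≤T'-v , proj₁ T'-u≤T-v , proj₂ T-u≤T'-v , proj₂ T'-u≤T-v
  where open LocalMeans tree uv e₁ e₂ e₃ e₄
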